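{- Let $q$ be a prime power, $n\geq1$, $\sigma\in\mathrm{Aut}(\mathbb F_q)$ and $M\in M_{n+1}(q)$, with $M^\perp=\{X\in M_{n+1}(q):\mathrm{Tr}(XM)=0\}$. Then \[|[M^\perp]\cap\Lambda_\sigma|=\frac{(q^{n+1}-1)(q^{n-1}-1)}{(q-1)^2}+\theta_M\, q^{n-1},\] where $\theta_M$ is the number of points $[\xi]\in\mathrm{PG}(V^*)$ such that $\ker(\xi^\sigma)\subseteq\ker(\xi M)$.
   Context: $V=\mathbb F_q^{n+1}$ (column vectors), $V^*$ row vectors, $\ker\xi=\{x\in V:\xi x=0\}$ (so $\ker$ of the zero functional is $V$); $A^\sigma$ means $\sigma$ applied entrywise. $\Lambda_\sigma=\{[x^\sigma\xi]: x\in V\setminus\{0\},\xi\in V^*\setminus\{0\},\xi x=0\}\subseteq\mathrm{PG}(M_{n+1}(q))$, and $[M^\perp]$ is the set of projective points of $M^\perp$. -}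

module Defs where

open import Data.Nat using (ℕ; zero; suc)
open import Data.Fin using (Fin; zero; suc)
open import Data.Bool using (Bool; true; false; _∧_; not; if_then_else_)
open import Data.Maybe using (Maybe; just; nothing)
open import Data.Product using (Σ)
open import Data.List using (List; []; _∷_; map; concatMap; allFin; filterᵇ; length)
open import Data.Bool.ListAction using (all; any)
open import Data.List.Membership.Propositional using (_∈_)
open import Data.List.Relation.Unary.Unique.Propositional using (Unique)
import Data.Vec.Functional as VF
open import Relation.Binary.PropositionalEquality using (_≡_)
open import Relation.Binary.Definitions using (DecidableEquality)
open import Relation.Nullary using (¬_; does)
open import Algebra.Structures using (IsCommutativeRing)

-- Every finite
-- field has prime-power order and every prime power occurs, so
-- "q a prime power, F_q" is rendered as "F a finite field, q = |F|".

record FiniteField : Set₁ where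
  infixl 7 _*_
  infixl 6 _+_
  field
    Carrier           : Set
    _+_ _*_           : Carrier → Carrier → Carrier
    -_                : Carrier → Carrier
    0# 1#             : Carrier
    isCommutativeRing : IsCommutativeRing _≡_ _+_ _*_ -_ 0# 1#
    0≢1               : ¬ (0# ≡ 1#)
    _⁻¹               : Carrier → Carrier
    inverseʳ          : ∀ x → ¬ (x ≡ 0#) → x * (x ⁻¹) ≡ 1#
    _≟_               : DecidableEquality Carrier
    elements          : List Carrier
    complete          : ∀ x → x ∈ elements
    unique            : Unique elements

  order : ℕ
  order = length elements

record FieldAut (F : FiniteField) : Set where
  open FiniteField F
  field
    σ          : Carrier → Carrier
    σ-+        : ∀ x y → σ (x + y) ≡ σ x + σ y
    σ-*        : ∀ x y → σ (x * y) ≡ σ x * σ y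
    σ-1        : σ 1# ≡ 1#
    injective  : ∀ x y → σ x ≡ σ y → x ≡ y
    surjective : ∀ y → Σ Carrier (λ x → σ x ≡ y)

allFuns : {A : Set} → List A → (m : ℕ) → List (Fin m → A)
allFuns xs zero    = (λ ()) ∷ []
allFuns xs (suc m) = concatMap (λ a → map (λ v → a VF.∷ v) (allFuns xs m)) xs

module LinAlg (F : FiniteField) where
  open FiniteField F

  Vect : ℕ → Set
  Vect m = Fin m → Carrier

  Mat : ℕ → Set
  Mat m = Fin m → Fin m → Carrier

  allVects : (m : ℕ) → List (Vect m)
  allVects m = allFuns elements m

  allMats : (m : ℕ) → List (Mat m)
  allMats m = allFuns (allVects m) m

  sumF : {m : ℕ} → (Fin m → Carrier) → Carrier
  sumF {zero}  f = 0#
  sumF {suc m} f = f zero + sumF (λ i → f (suc i))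

  isZero : Carrier → Bool
  isZero a = does (a ≟ 0#)

  isOne : Carrier → Bool
  isOne a = does (a ≟ 1#)

  eqB : Carrier → Carrier → Bool
  eqB a b = does (a ≟ b)

  apply : {m : ℕ} → Vect m → Vect m → Carrier
  apply ξ x = sumF (λ i → ξ i * x i)

  rowMul : {m : ℕ} → Vect m → Mat m → Vect m
  rowMul ξ M j = sumF (λ i → ξ i * M i j)

  trace : {m : ℕ} → Mat m → Carrier
  trace X = sumF (λ i → X i i)

  matMul : {m : ℕ} → Mat m → Mat m → Mat m
  matMul X Y i k = sumF (λ j → X i j * Y j k)

  vmap : {m : ℕ} → (Carrier → Carrier) → Vect m → Vect m
  vmap f v i = f (v i)

  outer : {m : ℕ} → Carrier → Vect m → Vect m → Mat m
  outer c x ξ i j = c * (x i * ξ j)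

  vecIsZero : {m : ℕ} → Vect m → Bool
  vecIsZero {m} v = all (λ i → isZero (v i)) (allFin m)

  matEq : {m : ℕ} → Mat m → Mat m → Bool
  matEq {m} X Y = all (λ i → all (λ j → eqB (X i j) (Y i j)) (allFin m)) (allFin m)

  -- Projective points are represented by their unique normalised
  -- representative: the first nonzero coordinate (in a fixed order)
  -- equals 1.  The zero vector has no leading entry.
  lead : {m : ℕ} → Vect m → Maybe Carrier
  lead {zero}  v = nothing
  lead {suc m} v = if isZero (v zero) then lead (λ i → v (suc i)) else just (v zero)

  leadRows : {k m : ℕ} → (Fin k → Vect m) → Maybe Carrier
  leadRows {zero}  X = nothing
  leadRows {suc k} X with lead (X zero)
  ... | just a  = just a
  ... | nothing = leadRows (λ i → X (suc i))

  isOneM : Maybe Carrier → Bool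
  isOneM (just a) = isOne a
  isOneM nothing  = false

  normalisedV : {m : ℕ} → Vect m → Bool
  normalisedV v = isOneM (lead v)

  normalisedM : {m : ℕ} → Mat m → Bool
  normalisedM X = isOneM (leadRows X)

  countᵇ : {A : Set} → (A → Bool) → List A → ℕ
  countᵇ p xs = length (filterᵇ p xs)

module Paper (F : FiniteField) (Aut : FieldAut F) where
  open FiniteField F
  open FieldAut Aut
  open LinAlg F

  inPerp : {m : ℕ} → Mat m → Mat m → Bool
  inPerp M X = isZero (trace (matMul X M))

  inΛ : {m : ℕ} → Mat m → Bool
  inΛ {m} X =
    any (λ c → not (isZero c) ∧
      any (λ x → not (vecIsZero x) ∧
        any (λ ξ → not (vecIsZero ξ) ∧ isZero (apply ξ x)
                   ∧ matEq X (outer c (vmap σ x) ξ))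
            (allVects m))
          (allVects m))
        elements

  countPerpΛ : {m : ℕ} → Mat m → ℕ
  countPerpΛ {m} M =
    countᵇ (λ X → normalisedM X ∧ inPerp M X ∧ inΛ X) (allMats m)

  kerCond : {m : ℕ} → Mat m → Vect m → Bool
  kerCond {m} M ξ =
    all (λ x → not (isZero (apply (vmap σ ξ) x)) ∨' isZero (apply (rowMul ξ M) x))
        (allVects m)
    where
    _∨'_ : Bool → Bool → Bool
    true  ∨' b = true
    false ∨' b = b

  θ : {m : ℕ} → Mat m → ℕ
  θ {m} M = countᵇ (λ ξ → normalisedV ξ ∧ kerCond M ξ) (allVects m)

module Submission where

-- Writing points of PG(V) and PG(V*) by their normalised representatives, the map
-- ([ξ], [x]) ↦ [x^σ ξ] is a bijection from the flags (ξ x = 0) onto the points of Λ_σ, and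
-- Tr(x^σ ξ M) = ξ M x^σ; so |[M^⊥] ∩ Λ_σ| counts flags with (ξ M) x^σ = 0.  Fix ξ ≠ 0.  Among
-- the q^n vectors of ker ξ, either all satisfy (ξ M) x^σ = 0, exactly when ker(ξ^σ) ⊆ ker(ξ M),
-- or the σ-semilinear form x ↦ (ξ M) x^σ maps ker ξ onto F_q with fibres of size q^(n-1).
-- Each nonzero vector is c y for a unique c ≠ 0 and normalised y, so an affine count A of a
-- scaling-invariant condition holding at 0 gives (A - 1)/(q - 1) points; summing over [ξ] then
-- yields the formula.

open import Defs

open import Algebra.Bundles using (CommutativeRing)
open import Data.Bool using (Bool; true; false; _∧_; not; T; T?; if_then_else_)
open import Data.Bool.ListAction using (all)
open import Data.Bool.Properties using (T-∧)
open import Data.Fin using (Fin; zero; suc)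
open import Data.List using (List; []; _∷_; _++_; map; concatMap; cartesianProduct; length; filterᵇ; allFin)
open import Data.List.Membership.Propositional using (_∈_; find; lose)
open import Data.List.Membership.Propositional.Properties using (∈-allFin; ∈-cartesianProduct⁻)
import Data.List.Relation.Unary.All as All
open import Data.List.Relation.Unary.All.Properties using (all⁺; all⁻; ¬All⇒Any¬)
open import Data.List.Relation.Unary.AllPairs using (_∷_)
open import Data.List.Relation.Unary.Any using (here; there)
open import Data.List.Relation.Unary.Any.Properties using (any⁺; any⁻)
open import Data.List.Relation.Unary.Unique.Propositional using (Unique)
open import Data.Maybe using (Maybe; just; nothing; _<∣>_)
import Data.Maybe as Maybe
open import Data.Nat using (ℕ; zero; suc)
open import Data.Product using (∃; _×_; _,_; proj₁; proj₂)
import Data.Product.Relation.Binary.Pointwise.NonDependent as ×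
import Data.Vec.Functional as VF
open import Data.Vec.Functional.Relation.Binary.Pointwise using (Pointwise)
import Data.Vec.Functional.Relation.Binary.Pointwise.Properties as Pointwise
open import Function using (_∘_; _⇔_; mk⇔; Equivalence)
open import Level using (0ℓ)
open import Relation.Binary using (Rel; Decidable; DecidableEquality; _Preserves_⟶_)
open import Relation.Binary.PropositionalEquality
open import Relation.Nullary using (¬_; Dec; yes; no; does; _×-dec_; ¬?; contradiction)
open import Relation.Nullary.Decidable using (dec-true; dec-false; does-⇔)

private
  variable
    A B C P Q : Set

does-sound : (p : Dec P) → T (does p) → P
does-sound (yes p) _ = p

does-complete : (p : Dec P) → P → T (does p)
does-complete p x = subst T (sym (dec-true p x)) _

T-not-sound : ∀ {b} → T (not b) → ¬ T b
T-not-sound {false} _ ()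

T-not-complete : ∀ {b} → ¬ T b → T (not b)
T-not-complete {false} _   = _
T-not-complete {true}  ¬tt = ¬tt _

T-all-allFin-sound : ∀ {m} (p : Fin m → Bool) → T (all p (allFin m)) → ∀ i → T (p i)
T-all-allFin-sound {m} p t i = All.lookup (all⁺ p (allFin m) t) (∈-allFin i)

T-all-allFin-complete : ∀ {m} (p : Fin m → Bool) → (∀ i → T (p i)) → T (all p (allFin m))
T-all-allFin-complete {m} p t = all⁻ p {allFin m} (All.tabulate λ {i} _ → t i)

module LinearAlgebra (F : FiniteField) where

  open FiniteField F
  open LinAlg F

  commutativeRing : CommutativeRing 0ℓ 0ℓ
  commutativeRing = record { isCommutativeRing = isCommutativeRing }

  open CommutativeRing commutativeRing
    using (+-identityˡ; +-identityʳ; -‿inverseʳ; *-assoc; *-comm; *-identityˡ; *-identityʳ;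
           distribˡ; zeroˡ; zeroʳ; *-commutativeSemigroup)
  open import Algebra.Properties.Group (CommutativeRing.+-group commutativeRing)
    using (x≈z//y; //-rightDividesˡ)
  open import Algebra.Properties.CommutativeSemigroup *-commutativeSemigroup
    using (x∙yz≈y∙xz)
  open import Algebra.Properties.CommutativeSemigroup (CommutativeRing.+-commutativeSemigroup commutativeRing)
    using () renaming (interchange to +-interchange)
  open ≡-Reasoning

  infix 4 _≈_ _≈?_ _≉?_ _≈ₘ_ _≈ₘ?_
  infixl 6 _+ᵥ_
  infixr 7 _·ᵥ_
  infix 8 -ᵥ_

  1≢0 : 1# ≢ 0#
  1≢0 1≡0 = 0≢1 (sym 1≡0)

  inverseˡ : ∀ a → a ≢ 0# → a ⁻¹ * a ≡ 1#
  inverseˡ a a≢0 = trans (*-comm (a ⁻¹) a) (inverseʳ a a≢0)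

  *-cancelˡ : ∀ {a b} c → c ≢ 0# → c * a ≡ c * b → a ≡ b
  *-cancelˡ {a} {b} c c≢0 ca≡cb = begin
    a                ≡⟨ cancel a ⟨
    c ⁻¹ * (c * a)   ≡⟨ cong (c ⁻¹ *_) ca≡cb ⟩
    c ⁻¹ * (c * b)   ≡⟨ cancel b ⟩
    b                ∎
    where
    cancel : ∀ x → c ⁻¹ * (c * x) ≡ x
    cancel x = trans (sym (*-assoc _ c x)) (trans (cong (_* x) (inverseˡ c c≢0)) (*-identityˡ x))

  c*a≡0⇒a≡0 : ∀ {a} c → c ≢ 0# → c * a ≡ 0# → a ≡ 0#
  c*a≡0⇒a≡0 c c≢0 ca≡0 = *-cancelˡ c c≢0 (trans ca≡0 (sym (zeroʳ c)))

  *-≡0⇔ : ∀ {a} c → c ≢ 0# → c * a ≡ 0# ⇔ a ≡ 0#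
  *-≡0⇔ c c≢0 = mk⇔ (c*a≡0⇒a≡0 c c≢0) (λ { refl → zeroʳ c })

  *-≢0 : ∀ {a b} → a ≢ 0# → b ≢ 0# → a * b ≢ 0#
  *-≢0 {a} a≢0 b≢0 ab≡0 = b≢0 (c*a≡0⇒a≡0 a a≢0 ab≡0)

  ⁻¹-≢0 : ∀ {a} → a ≢ 0# → a ⁻¹ ≢ 0#
  ⁻¹-≢0 {a} a≢0 a⁻¹≡0 = 0≢1 (begin
    0#         ≡⟨ zeroʳ a ⟨
    a * 0#     ≡⟨ cong (a *_) a⁻¹≡0 ⟨
    a * a ⁻¹   ≡⟨ inverseʳ a a≢0 ⟩
    1#         ∎)

  x+y≡y⇒x≡0 : ∀ {x y} → x + y ≡ y → x ≡ 0#
  x+y≡y⇒x≡0 {x} {y} x+y≡y = trans (x≈z//y x y y x+y≡y) (-‿inverseʳ y)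

  x≡y+x⇔y≡0 : ∀ {x y} → x ≡ y + x ⇔ y ≡ 0#
  x≡y+x⇔y≡0 {x} = mk⇔ (λ x≡y+x → x+y≡y⇒x≡0 (sym x≡y+x)) (λ { refl → sym (+-identityˡ x) })

  sumF-cong : ∀ {m} {f g : Fin m → Carrier} → (∀ i → f i ≡ g i) → sumF f ≡ sumF g
  sumF-cong {zero}  f≗g = refl
  sumF-cong {suc m} f≗g = cong₂ _+_ (f≗g zero) (sumF-cong (f≗g ∘ suc))

  sumF-0 : ∀ {m} → sumF {m} (λ _ → 0#) ≡ 0#
  sumF-0 {zero}  = refl
  sumF-0 {suc m} = trans (+-identityˡ _) (sumF-0 {m})

  sumF-+ : ∀ {m} (f g : Fin m → Carrier) → sumF (λ i → f i + g i) ≡ sumF f + sumF g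
  sumF-+ {zero}  f g = sym (+-identityʳ 0#)
  sumF-+ {suc m} f g = trans (cong (f zero + g zero +_) (sumF-+ (f ∘ suc) (g ∘ suc)))
                             (+-interchange (f zero) (g zero) _ _)

  sumF-*ˡ : ∀ {m} c (f : Fin m → Carrier) → sumF (λ i → c * f i) ≡ c * sumF f
  sumF-*ˡ {zero}  c f = sym (zeroʳ c)
  sumF-*ˡ {suc m} c f = trans (cong (c * f zero +_) (sumF-*ˡ c (f ∘ suc))) (sym (distribˡ c (f zero) _))

  _≈_ : ∀ {m} → Rel (Vect m) 0ℓ
  _≈_ = Pointwise _≡_

  _≈?_ : ∀ {m} → Decidable (_≈_ {m})
  _≈?_ = Pointwise.decidable _≟_

  _≉?_ : ∀ {m} (u v : Vect m) → Dec (¬ (u ≈ v))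
  u ≉? v = ¬? (u ≈? v)

  ≈-sym : ∀ {m} {u v : Vect m} → u ≈ v → v ≈ u
  ≈-sym u≈v i = sym (u≈v i)

  ≈-trans : ∀ {m} {u v w : Vect m} → u ≈ v → v ≈ w → u ≈ w
  ≈-trans u≈v v≈w i = trans (u≈v i) (v≈w i)

  0ᵥ : ∀ {m} → Vect m
  0ᵥ _ = 0#

  _+ᵥ_ : ∀ {m} → Vect m → Vect m → Vect m
  (u +ᵥ v) i = u i + v i

  _·ᵥ_ : ∀ {m} → Carrier → Vect m → Vect m
  (c ·ᵥ v) i = c * v i

  -ᵥ_ : ∀ {m} → Vect m → Vect m
  (-ᵥ v) i = - v i

  unit : ∀ {m} → Fin m → Vect m
  unit zero    zero    = 1#
  unit zero    (suc i) = 0#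
  unit (suc k) zero    = 0#
  unit (suc k) (suc i) = unit k i

  +ᵥ-transpose : ∀ {m} {u v w : Vect m} → u ≈ v +ᵥ w ⇔ v ≈ u +ᵥ (-ᵥ w)
  +ᵥ-transpose {u = u} {v} {w} = mk⇔
    (λ u≈v+w i → x≈z//y (v i) (w i) (u i) (sym (u≈v+w i)))
    (λ v≈u-w i → sym (trans (cong (_+ w i) (v≈u-w i)) (//-rightDividesˡ (w i) (u i))))

  ·ᵥ-inverseʳ : ∀ {m} {a} → a ≢ 0# → (x : Vect m) → a ·ᵥ (a ⁻¹ ·ᵥ x) ≈ x
  ·ᵥ-inverseʳ {a = a} a≢0 x i =
    trans (sym (*-assoc a _ (x i))) (trans (cong (_* x i) (inverseʳ a a≢0)) (*-identityˡ (x i)))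

  ·ᵥ-inverseˡ : ∀ {m} {a} → a ≢ 0# → (x : Vect m) → a ⁻¹ ·ᵥ (a ·ᵥ x) ≈ x
  ·ᵥ-inverseˡ {a = a} a≢0 x i =
    trans (sym (*-assoc _ a (x i))) (trans (cong (_* x i) (inverseˡ a a≢0)) (*-identityˡ (x i)))

  vecIsZero-sound : ∀ {m} {v : Vect m} → T (vecIsZero v) → v ≈ 0ᵥ
  vecIsZero-sound {v = v} t i = does-sound (v i ≟ 0#) (T-all-allFin-sound _ t i)

  vecIsZero-complete : ∀ {m} {v : Vect m} → v ≈ 0ᵥ → T (vecIsZero v)
  vecIsZero-complete {v = v} v≈0 = T-all-allFin-complete _ (λ i → does-complete (v i ≟ 0#) (v≈0 i))

  apply-cong : ∀ {m} {ξ η x y : Vect m} → ξ ≈ η → x ≈ y → apply ξ x ≡ apply η y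
  apply-cong {m} ξ≈η x≈y = sumF-cong {m} (λ i → cong₂ _*_ (ξ≈η i) (x≈y i))

  apply-congʳ : ∀ {m} (ξ : Vect m) {x y : Vect m} → x ≈ y → apply ξ x ≡ apply ξ y
  apply-congʳ ξ = apply-cong {ξ = ξ} (λ _ → refl)

  apply-0ʳ : ∀ {m} (ξ : Vect m) → apply ξ 0ᵥ ≡ 0#
  apply-0ʳ {m} ξ = trans (sumF-cong {m} (λ i → zeroʳ (ξ i))) (sumF-0 {m})

  apply-+ʳ : ∀ {m} (ξ u v : Vect m) → apply ξ (u +ᵥ v) ≡ apply ξ u + apply ξ v
  apply-+ʳ {m} ξ u v = trans (sumF-cong {m} (λ i → distribˡ (ξ i) (u i) (v i))) (sumF-+ {m} _ _)

  apply-·ʳ : ∀ {m} c (ξ x : Vect m) → apply ξ (c ·ᵥ x) ≡ c * apply ξ x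
  apply-·ʳ {m} c ξ x = trans (sumF-cong {m} (λ i → x∙yz≈y∙xz (ξ i) c (x i))) (sumF-*ˡ {m} c _)

  apply-·ˡ : ∀ {m} c (ξ x : Vect m) → apply (c ·ᵥ ξ) x ≡ c * apply ξ x
  apply-·ˡ {m} c ξ x = trans (sumF-cong {m} (λ i → *-assoc c (ξ i) (x i))) (sumF-*ˡ {m} c _)

  apply-unitʳ : ∀ {m} (ξ : Vect m) k → apply ξ (unit k) ≡ ξ k
  apply-unitʳ {suc m} ξ zero    = begin
    ξ zero * 1# + apply (ξ ∘ suc) 0ᵥ
      ≡⟨ cong₂ _+_ (*-identityʳ (ξ zero)) (apply-0ʳ (ξ ∘ suc)) ⟩
    ξ zero + 0#
      ≡⟨ +-identityʳ (ξ zero) ⟩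
    ξ zero ∎
  apply-unitʳ {suc m} ξ (suc k) = begin
    ξ zero * 0# + apply (ξ ∘ suc) (unit k)
      ≡⟨ cong₂ _+_ (zeroʳ (ξ zero)) (apply-unitʳ (ξ ∘ suc) k) ⟩
    0# + ξ (suc k)
      ≡⟨ +-identityˡ _ ⟩
    ξ (suc k) ∎

  apply-shift-unit : ∀ {m} (ξ : Vect m) k → ξ k ≢ 0# → ∀ c v →
                     apply ξ (v +ᵥ (c * ξ k ⁻¹) ·ᵥ unit k) ≡ apply ξ v + c
  apply-shift-unit ξ k ξk≢0 c v = begin
    apply ξ (v +ᵥ (c * ξ k ⁻¹) ·ᵥ unit k)
      ≡⟨ apply-+ʳ ξ v ((c * ξ k ⁻¹) ·ᵥ unit k) ⟩
    apply ξ v + apply ξ ((c * ξ k ⁻¹) ·ᵥ unit k)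
      ≡⟨ cong (apply ξ v +_) (apply-·ʳ (c * ξ k ⁻¹) ξ (unit k)) ⟩
    apply ξ v + c * ξ k ⁻¹ * apply ξ (unit k)
      ≡⟨ cong (λ t → apply ξ v + c * ξ k ⁻¹ * t) (apply-unitʳ ξ k) ⟩
    apply ξ v + c * ξ k ⁻¹ * ξ k
      ≡⟨ cong (apply ξ v +_) (*-assoc c _ _) ⟩
    apply ξ v + c * (ξ k ⁻¹ * ξ k)
      ≡⟨ cong (λ t → apply ξ v + c * t) (inverseˡ (ξ k) ξk≢0) ⟩
    apply ξ v + c * 1#
      ≡⟨ cong (apply ξ v +_) (*-identityʳ c) ⟩
    apply ξ v + c ∎

  _≈ₘ_ : ∀ {m} → Rel (Mat m) 0ℓ
  _≈ₘ_ = Pointwise _≈_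

  _≈ₘ?_ : ∀ {m} → Decidable (_≈ₘ_ {m})
  _≈ₘ?_ = Pointwise.decidable _≈?_

  ≈ₘ-sym : ∀ {m} {X Y : Mat m} → X ≈ₘ Y → Y ≈ₘ X
  ≈ₘ-sym X≈Y i = ≈-sym (X≈Y i)

  ≈ₘ-trans : ∀ {m} {X Y Z : Mat m} → X ≈ₘ Y → Y ≈ₘ Z → X ≈ₘ Z
  ≈ₘ-trans X≈Y Y≈Z i = ≈-trans (X≈Y i) (Y≈Z i)

  matEq-sound : ∀ {m} {X Y : Mat m} → T (matEq X Y) → X ≈ₘ Y
  matEq-sound {X = X} {Y} t i j = does-sound (X i j ≟ Y i j) (T-all-allFin-sound _ (T-all-allFin-sound _ t i) j)

  matEq-complete : ∀ {m} {X Y : Mat m} → X ≈ₘ Y → T (matEq X Y)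
  matEq-complete {X = X} {Y} X≈Y =
    T-all-allFin-complete _ λ i → T-all-allFin-complete _ λ j → does-complete (X i j ≟ Y i j) (X≈Y i j)

  trace-outer : ∀ {m} (M : Mat m) c (x ξ : Vect m) →
                trace (matMul (outer c x ξ) M) ≡ c * apply (rowMul ξ M) x
  trace-outer {m} M c x ξ = begin
    sumF (λ i → sumF (λ j → c * (x i * ξ j) * M j i))
      ≡⟨ sumF-cong {m} (λ i → sumF-cong {m} (λ j → regroup (x i) (ξ j) (M j i))) ⟩
    sumF (λ i → sumF (λ j → c * x i * (ξ j * M j i)))
      ≡⟨ sumF-cong {m} (λ i → sumF-*ˡ {m} (c * x i) _) ⟩
    sumF (λ i → c * x i * rowMul ξ M i)
      ≡⟨ sumF-cong {m} (λ i → trans (*-assoc c _ _) (cong (c *_) (*-comm (x i) _))) ⟩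
    sumF (λ i → c * (rowMul ξ M i * x i))
      ≡⟨ sumF-*ˡ {m} c _ ⟩
    c * apply (rowMul ξ M) x ∎
    where
    regroup : ∀ a b d → c * (a * b) * d ≡ c * a * (b * d)
    regroup a b d = trans (cong (_* d) (sym (*-assoc c a b))) (*-assoc (c * a) b d)

  trace-matMul-cong : ∀ {m} (M : Mat m) {X Y : Mat m} → X ≈ₘ Y →
                      trace (matMul X M) ≡ trace (matMul Y M)
  trace-matMul-cong {m} M X≈Y = sumF-cong {m} (λ i → sumF-cong {m} (λ j → cong (_* M j i) (X≈Y i j)))

  lead-cong : ∀ {m} {v w : Vect m} → v ≈ w → lead v ≡ lead w
  lead-cong {zero}  v≈w = refl
  lead-cong {suc m} v≈w =
    cong₂ (λ a r → if isZero a then r else just a) (v≈w zero) (lead-cong (v≈w ∘ suc))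

  ≈0⇒lead≡nothing : ∀ {m} {v : Vect m} → v ≈ 0ᵥ → lead v ≡ nothing
  ≈0⇒lead≡nothing {zero}      v≈0 = refl
  ≈0⇒lead≡nothing {suc m} {v} v≈0 with v zero ≟ 0#
  ... | yes _   = ≈0⇒lead≡nothing (v≈0 ∘ suc)
  ... | no  v₀≢0 = contradiction (v≈0 zero) v₀≢0

  lead≡nothing⇒≈0 : ∀ {m} {v : Vect m} → lead v ≡ nothing → v ≈ 0ᵥ
  lead≡nothing⇒≈0 {suc m} {v} lv≡nothing i with v zero ≟ 0# | i
  ... | yes v₀≡0 | zero  = v₀≡0
  ... | yes _    | suc i = lead≡nothing⇒≈0 {v = v ∘ suc} lv≡nothing i
  ... | no  _    | _     with () ← lv≡nothing

  lead≡just⇒≉0 : ∀ {m} {v : Vect m} {a} → lead v ≡ just a → ¬ (v ≈ 0ᵥ)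
  lead≡just⇒≉0 lv≡a v≈0 with () ← trans (sym lv≡a) (≈0⇒lead≡nothing v≈0)

  nonzero⇒lead : ∀ {m} {v : Vect m} → ¬ (v ≈ 0ᵥ) → ∃ λ a → lead v ≡ just a
  nonzero⇒lead {v = v} v≉0 with lead v in lv
  ... | just a  = a , refl
  ... | nothing = contradiction (lead≡nothing⇒≈0 lv) v≉0

  lead-≢0 : ∀ {m} {v : Vect m} {a} → lead v ≡ just a → a ≢ 0#
  lead-≢0 {suc m} {v} lv≡a with v zero ≟ 0#
  ... | yes _    = lead-≢0 {v = v ∘ suc} lv≡a
  ... | no  v₀≢0 with refl ← lv≡a = v₀≢0

  lead-entry : ∀ {m} {v : Vect m} {a} → lead v ≡ just a → ∃ λ k → v k ≡ a
  lead-entry {suc m} {v} lv≡a with v zero ≟ 0#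
  ... | yes _ = let k , vk≡a = lead-entry {v = v ∘ suc} lv≡a in suc k , vk≡a
  ... | no  _ with refl ← lv≡a = zero , refl

  lead-·ᵥ : ∀ {m} {c} (v : Vect m) → c ≢ 0# → lead (c ·ᵥ v) ≡ Maybe.map (c *_) (lead v)
  lead-·ᵥ {zero}      v c≢0 = refl
  lead-·ᵥ {suc m} {c} v c≢0 with v zero ≟ 0# | (c * v zero) ≟ 0#
  ... | yes _    | yes _     = lead-·ᵥ (v ∘ suc) c≢0
  ... | yes v₀≡0 | no  cv₀≢0 = contradiction (trans (cong (c *_) v₀≡0) (zeroʳ c)) cv₀≢0
  ... | no  v₀≢0 | yes cv₀≡0 = contradiction cv₀≡0 (*-≢0 c≢0 v₀≢0)
  ... | no  _    | no  _     = refl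

  leadRows-cong : ∀ {k m} {X Y : Fin k → Vect m} → (∀ i → X i ≈ Y i) →
                  leadRows X ≡ leadRows Y
  leadRows-cong {zero}          X≈Y = refl
  leadRows-cong {suc k} {X = X} {Y} X≈Y with lead (X zero) | lead (Y zero) | lead-cong (X≈Y zero)
  ... | just a  | .(just a) | refl = refl
  ... | nothing | .nothing  | refl = leadRows-cong (X≈Y ∘ suc)

  leadRows-suc : ∀ {k m} (X : Fin (suc k) → Vect m) →
                 leadRows X ≡ lead (X zero) <∣> leadRows (X ∘ suc)
  leadRows-suc X with lead (X zero)
  ... | just _  = refl
  ... | nothing = refl

  leadRows-·ᵥ : ∀ {k m} (s : Vect k) {ξ : Vect m} {b} → lead ξ ≡ just b →
                leadRows (λ i → s i ·ᵥ ξ) ≡ Maybe.map (_* b) (lead s)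
  leadRows-·ᵥ {zero}  s lξ≡b = refl
  leadRows-·ᵥ {suc k} s {ξ} {b} lξ≡b with s zero ≟ 0#
  ... | yes s₀≡0 = begin
    leadRows (λ i → s i ·ᵥ ξ)
      ≡⟨ leadRows-suc (λ i → s i ·ᵥ ξ) ⟩
    lead (s zero ·ᵥ ξ) <∣> leadRows (λ i → s (suc i) ·ᵥ ξ)
      ≡⟨ cong (_<∣> leadRows (λ i → s (suc i) ·ᵥ ξ)) (≈0⇒lead≡nothing s₀ξ≈0) ⟩
    leadRows (λ i → s (suc i) ·ᵥ ξ)
      ≡⟨ leadRows-·ᵥ (s ∘ suc) lξ≡b ⟩
    Maybe.map (_* b) (lead (s ∘ suc)) ∎
    where
    s₀ξ≈0 : s zero ·ᵥ ξ ≈ 0ᵥ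
    s₀ξ≈0 j = trans (cong (_* ξ j) s₀≡0) (zeroˡ (ξ j))
  ... | no s₀≢0 = begin
    leadRows (λ i → s i ·ᵥ ξ)
      ≡⟨ leadRows-suc (λ i → s i ·ᵥ ξ) ⟩
    lead (s zero ·ᵥ ξ) <∣> leadRows (λ i → s (suc i) ·ᵥ ξ)
      ≡⟨ cong (_<∣> leadRows (λ i → s (suc i) ·ᵥ ξ)) (lead-·ᵥ ξ s₀≢0) ⟩
    Maybe.map (s zero *_) (lead ξ) <∣> leadRows (λ i → s (suc i) ·ᵥ ξ)
      ≡⟨ cong (λ r → Maybe.map (s zero *_) r <∣> leadRows (λ i → s (suc i) ·ᵥ ξ)) lξ≡b ⟩
    just (s zero * b) ∎

  leadRows-outer : ∀ {m a b} c (x ξ : Vect m) → c ≢ 0# → lead x ≡ just a → lead ξ ≡ just b →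
                   leadRows (outer c x ξ) ≡ just (c * a * b)
  leadRows-outer {a = a} {b} c x ξ c≢0 lx≡a lξ≡b = begin
    leadRows (outer c x ξ)
      ≡⟨ leadRows-cong (λ i j → sym (*-assoc c (x i) (ξ j))) ⟩
    leadRows (λ i → (c ·ᵥ x) i ·ᵥ ξ)
      ≡⟨ leadRows-·ᵥ (c ·ᵥ x) lξ≡b ⟩
    Maybe.map (_* b) (lead (c ·ᵥ x))
      ≡⟨ cong (Maybe.map (_* b)) (trans (lead-·ᵥ x c≢0) (cong (Maybe.map (c *_)) lx≡a)) ⟩
    just (c * a * b) ∎

  isOneM-sound : ∀ {r} → T (isOneM r) → r ≡ just 1#
  isOneM-sound {just a} t = cong just (does-sound (a ≟ 1#) t)

  isOneM-complete : ∀ {r} → r ≡ just 1# → T (isOneM r)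
  isOneM-complete refl = does-complete (1# ≟ 1#) refl

  normalised-lead : ∀ {m} (v : Vect m) → T (normalisedV v) → lead v ≡ just 1#
  normalised-lead v = isOneM-sound

  normalised⇒≉0 : ∀ {m} {v : Vect m} → T (normalisedV v) → ¬ (v ≈ 0ᵥ)
  normalised⇒≉0 {v = v} t = lead≡just⇒≉0 (normalised-lead v t)

  lead-normalise : ∀ {m} (x : Vect m) {a} → lead x ≡ just a → lead (a ⁻¹ ·ᵥ x) ≡ just 1#
  lead-normalise x {a} lx≡a = begin
    lead (a ⁻¹ ·ᵥ x)                ≡⟨ lead-·ᵥ x (⁻¹-≢0 a≢0) ⟩
    Maybe.map (a ⁻¹ *_) (lead x)    ≡⟨ cong (Maybe.map (a ⁻¹ *_)) lx≡a ⟩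
    just (a ⁻¹ * a)                 ≡⟨ cong just (inverseˡ a a≢0) ⟩
    just 1#                         ∎
    where
    a≢0 = lead-≢0 {v = x} lx≡a

  lead-·ᵥ-normalised : ∀ {m} {c} (y : Vect m) → c ≢ 0# → lead y ≡ just 1# →
                       lead (c ·ᵥ y) ≡ just c
  lead-·ᵥ-normalised {c = c} y c≢0 ly≡1 =
    trans (lead-·ᵥ y c≢0) (trans (cong (Maybe.map (c *_)) ly≡1) (cong just (*-identityʳ c)))

  ·ᵥ-normalised⇔ : ∀ {m} {x y : Vect m} {a c} → lead x ≡ just a →
                   ((c ≢ 0# × T (normalisedV y)) × x ≈ c ·ᵥ y) ⇔ (c ≡ a × y ≈ a ⁻¹ ·ᵥ x)
  ·ᵥ-normalised⇔ {x = x} {y} {a} {c} lx≡a = mk⇔ to from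
    where
    a≢0 = lead-≢0 {v = x} lx≡a
    to : (c ≢ 0# × T (normalisedV y)) × x ≈ c ·ᵥ y → c ≡ a × y ≈ a ⁻¹ ·ᵥ x
    to ((c≢0 , ny) , x≈cy)
      with trans (sym lx≡a) (trans (lead-cong x≈cy) (lead-·ᵥ-normalised y c≢0 (isOneM-sound ny)))
    ... | refl = refl , λ i → trans (sym (·ᵥ-inverseˡ c≢0 y i)) (cong (c ⁻¹ *_) (sym (x≈cy i)))
    from : c ≡ a × y ≈ a ⁻¹ ·ᵥ x → (c ≢ 0# × T (normalisedV y)) × x ≈ c ·ᵥ y
    from (refl , y≈a⁻¹x) =
      (a≢0 , isOneM-complete (trans (lead-cong y≈a⁻¹x) (lead-normalise x lx≡a))) ,
      λ i → trans (sym (·ᵥ-inverseʳ a≢0 x i)) (cong (c *_) (sym (y≈a⁻¹x i)))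

  normalised-≈-·ᵥ : ∀ {m} {y z : Vect m} {c} →
                    lead y ≡ just 1# → lead z ≡ just 1# → y ≈ c ·ᵥ z → y ≈ z
  normalised-≈-·ᵥ {y = y} {z} {c} ly≡1 lz≡1 y≈cz with c ≟ 0#
  ... | yes c≡0 = contradiction y≈0 (lead≡just⇒≉0 ly≡1)
    where
    y≈0 : y ≈ 0ᵥ
    y≈0 i = trans (y≈cz i) (trans (cong (_* z i) c≡0) (zeroˡ (z i)))
  ... | no c≢0 with trans (sym ly≡1) (trans (lead-cong y≈cz) (lead-·ᵥ-normalised z c≢0 lz≡1))
  ...   | refl = λ i → trans (y≈cz i) (*-identityˡ (z i))

  outer-injective : ∀ {m} {u u′ ξ ξ′ : Vect m} →
                    lead u ≡ just 1# → lead u′ ≡ just 1# → lead ξ ≡ just 1# → lead ξ′ ≡ just 1# →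
                    (∀ i j → u i * ξ j ≡ u′ i * ξ′ j) → u ≈ u′ × ξ ≈ ξ′
  outer-injective {u = u} {u′} {ξ} {ξ′} lu lu′ lξ lξ′ uξ≡u′ξ′
    with lead-entry {v = u} lu | lead-entry {v = ξ} lξ
  ... | i , ui≡1 | k , ξk≡1 = normalised-≈-·ᵥ lu lu′ u≈ξ′k·u′ , normalised-≈-·ᵥ lξ lξ′ ξ≈u′i·ξ′
    where
    u≈ξ′k·u′ : u ≈ ξ′ k ·ᵥ u′
    u≈ξ′k·u′ i′ = begin
      u i′          ≡⟨ *-identityʳ (u i′) ⟨
      u i′ * 1#     ≡⟨ cong (u i′ *_) ξk≡1 ⟨
      u i′ * ξ k    ≡⟨ uξ≡u′ξ′ i′ k ⟩
      u′ i′ * ξ′ k  ≡⟨ *-comm (u′ i′) (ξ′ k) ⟩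
      ξ′ k * u′ i′  ∎
    ξ≈u′i·ξ′ : ξ ≈ u′ i ·ᵥ ξ′
    ξ≈u′i·ξ′ j = begin
      ξ j           ≡⟨ *-identityˡ (ξ j) ⟨
      1# * ξ j      ≡⟨ cong (_* ξ j) ui≡1 ⟨
      u i * ξ j     ≡⟨ uξ≡u′ξ′ i j ⟩
      u′ i * ξ′ j   ∎

  module Semilinear (Aut : FieldAut F) where

    open FieldAut Aut

    σ-0 : σ 0# ≡ 0#
    σ-0 = x+y≡y⇒x≡0 (trans (sym (σ-+ 0# 0#)) (cong σ (+-identityˡ 0#)))

    σ-≡0 : ∀ {a} → σ a ≡ 0# → a ≡ 0#
    σ-≡0 {a} σa≡0 = injective a 0# (trans σa≡0 (sym σ-0))

    σ-≢0 : ∀ {a} → a ≢ 0# → σ a ≢ 0#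
    σ-≢0 a≢0 = a≢0 ∘ σ-≡0

    σ⁻ : Carrier → Carrier
    σ⁻ a = proj₁ (surjective a)

    σ-σ⁻ : ∀ a → σ (σ⁻ a) ≡ a
    σ-σ⁻ a = proj₂ (surjective a)

    σ-sumF : ∀ {m} (f : Fin m → Carrier) → σ (sumF f) ≡ sumF (σ ∘ f)
    σ-sumF {zero}  f = σ-0
    σ-sumF {suc m} f = trans (σ-+ _ _) (cong (σ (f zero) +_) (σ-sumF (f ∘ suc)))

    σ-apply : ∀ {m} (ξ x : Vect m) → σ (apply ξ x) ≡ apply (vmap σ ξ) (vmap σ x)
    σ-apply {m} ξ x = trans (σ-sumF {m} _) (sumF-cong {m} (λ i → σ-* (ξ i) (x i)))

    vmap-+ᵥ : ∀ {m} (u v : Vect m) → vmap σ (u +ᵥ v) ≈ vmap σ u +ᵥ vmap σ v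
    vmap-+ᵥ u v i = σ-+ (u i) (v i)

    vmap-·ᵥ : ∀ {m} c (v : Vect m) → vmap σ (c ·ᵥ v) ≈ σ c ·ᵥ vmap σ v
    vmap-·ᵥ c v i = σ-* c (v i)

    lead-vmap : ∀ {m} (v : Vect m) → lead (vmap σ v) ≡ Maybe.map σ (lead v)
    lead-vmap {zero}  v = refl
    lead-vmap {suc m} v with v zero ≟ 0# | σ (v zero) ≟ 0#
    ... | yes _    | yes _     = lead-vmap (v ∘ suc)
    ... | yes v₀≡0 | no  σv₀≢0 = contradiction (trans (cong σ v₀≡0) σ-0) σv₀≢0
    ... | no  v₀≢0 | yes σv₀≡0 = contradiction σv₀≡0 (σ-≢0 v₀≢0)
    ... | no  _    | no  _     = refl

    outer-rescale : ∀ {m a} c (y η : Vect m) → a ≢ 0# →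
                    outer c (vmap σ y) η ≈ₘ outer 1# (vmap σ (a ⁻¹ ·ᵥ y)) ((c * σ a) ·ᵥ η)
    outer-rescale {a = a} c y η a≢0 i j = begin
      c * (σ (y i) * η j)
        ≡⟨ cong (λ z → c * (σ z * η j)) (·ᵥ-inverseʳ a≢0 y i) ⟨
      c * (σ (a * s) * η j)
        ≡⟨ cong (λ z → c * (z * η j)) (σ-* a s) ⟩
      c * (σ a * σ s * η j)
        ≡⟨ cong (c *_) (*-assoc (σ a) (σ s) (η j)) ⟩
      c * (σ a * (σ s * η j))
        ≡⟨ *-assoc c (σ a) _ ⟨
      c * σ a * (σ s * η j)
        ≡⟨ x∙yz≈y∙xz (c * σ a) (σ s) (η j) ⟩
      σ s * (c * σ a * η j)
        ≡⟨ *-identityˡ _ ⟨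
      1# * (σ s * (c * σ a * η j)) ∎
      where
      s = a ⁻¹ * y i

    shift-along-kernel : ∀ {m} (ξ η x₀ : Vect m) → apply ξ x₀ ≡ 0# → apply η (vmap σ x₀) ≢ 0# → ∀ c →
                         ∃ λ w → (∀ v → apply ξ (v +ᵥ w) ≡ apply ξ v) ×
                                 (∀ v → apply η (vmap σ (v +ᵥ w)) ≡ apply η (vmap σ v) + c)
    shift-along-kernel ξ η x₀ ξx₀≡0 d≢0 c = t ·ᵥ x₀ , in-kernel , shift
      where
      d = apply η (vmap σ x₀)
      t = σ⁻ (c * d ⁻¹)
      in-kernel : ∀ v → apply ξ (v +ᵥ t ·ᵥ x₀) ≡ apply ξ v
      in-kernel v = begin
        apply ξ (v +ᵥ t ·ᵥ x₀)
          ≡⟨ apply-+ʳ ξ v (t ·ᵥ x₀) ⟩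
        apply ξ v + apply ξ (t ·ᵥ x₀)
          ≡⟨ cong (apply ξ v +_) (trans (apply-·ʳ t ξ x₀) (trans (cong (t *_) ξx₀≡0) (zeroʳ t))) ⟩
        apply ξ v + 0#
          ≡⟨ +-identityʳ _ ⟩
        apply ξ v ∎
      shift : ∀ v → apply η (vmap σ (v +ᵥ t ·ᵥ x₀)) ≡ apply η (vmap σ v) + c
      shift v = begin
        apply η (vmap σ (v +ᵥ t ·ᵥ x₀))
          ≡⟨ apply-congʳ η (λ i → trans (vmap-+ᵥ v (t ·ᵥ x₀) i) (cong (σ (v i) +_) (vmap-·ᵥ t x₀ i))) ⟩
        apply η (vmap σ v +ᵥ σ t ·ᵥ vmap σ x₀)
          ≡⟨ apply-+ʳ η (vmap σ v) (σ t ·ᵥ vmap σ x₀) ⟩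
        apply η (vmap σ v) + apply η (σ t ·ᵥ vmap σ x₀)
          ≡⟨ cong (apply η (vmap σ v) +_) (apply-·ʳ (σ t) η (vmap σ x₀)) ⟩
        apply η (vmap σ v) + σ t * d
          ≡⟨ cong (λ z → apply η (vmap σ v) + z * d) (σ-σ⁻ (c * d ⁻¹)) ⟩
        apply η (vmap σ v) + c * d ⁻¹ * d
          ≡⟨ cong (apply η (vmap σ v) +_) (*-assoc c (d ⁻¹) d) ⟩
        apply η (vmap σ v) + c * (d ⁻¹ * d)
          ≡⟨ cong (λ z → apply η (vmap σ v) + c * z) (inverseˡ d d≢0) ⟩
        apply η (vmap σ v) + c * 1#
          ≡⟨ cong (apply η (vmap σ v) +_) (*-identityʳ c) ⟩
        apply η (vmap σ v) + c ∎

-- Imported only here, so that LinearAlgebra above can use the field's _+_ and _*_ unqualified.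
open import Data.Nat using (_+_; _*_; _^_; _∸_; _≤_; _<_)
open import Data.Nat.Properties
  using (+-assoc; +-comm; +-identityʳ; *-assoc; *-comm; *-zeroʳ; *-identityʳ; *-identityˡ; *-distribˡ-+; *-distribʳ-+;
         *-cancelˡ-≡; +-cancelʳ-≡; m+n∸n≡m; m^n>0; +-commutativeSemigroup)
open import Data.Nat.Tactic.RingSolver using (solve-∀)
open import Algebra.Properties.CommutativeSemigroup +-commutativeSemigroup
  using () renaming (interchange to +-interchange)

∑ : List A → (A → ℕ) → ℕ
∑ []       f = 0
∑ (x ∷ xs) f = f x + ∑ xs f

syntax ∑ xs (λ x → e) = ∑[ x ∈ xs ] e

𝟙ᵇ : Bool → ℕ
𝟙ᵇ true  = 1
𝟙ᵇ false = 0

𝟙 : {P : Set} → Dec P → ℕ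
𝟙 p = 𝟙ᵇ (does p)

∑-cong : (xs : List A) {f g : A → ℕ} → (∀ x → f x ≡ g x) → ∑ xs f ≡ ∑ xs g
∑-cong []       f≗g = refl
∑-cong (x ∷ xs) f≗g = cong₂ _+_ (f≗g x) (∑-cong xs f≗g)

∑-zero : (xs : List A) {f : A → ℕ} → (∀ x → x ∈ xs → f x ≡ 0) → ∑ xs f ≡ 0
∑-zero []       f≡0 = refl
∑-zero (x ∷ xs) f≡0 = cong₂ _+_ (f≡0 x (here refl)) (∑-zero xs (λ y → f≡0 y ∘ there))

∑-++ : (xs ys : List A) (f : A → ℕ) → ∑ (xs ++ ys) f ≡ ∑ xs f + ∑ ys f
∑-++ []       ys f = refl
∑-++ (x ∷ xs) ys f = trans (cong (f x +_) (∑-++ xs ys f)) (sym (+-assoc (f x) _ _))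

∑-map : (g : A → B) (xs : List A) (f : B → ℕ) → ∑ (map g xs) f ≡ ∑[ x ∈ xs ] f (g x)
∑-map g []       f = refl
∑-map g (x ∷ xs) f = cong (f (g x) +_) (∑-map g xs f)

∑-+ : (xs : List A) (f g : A → ℕ) → ∑[ x ∈ xs ] (f x + g x) ≡ ∑ xs f + ∑ xs g
∑-+ []       f g = refl
∑-+ (x ∷ xs) f g = begin
  f x + g x + ∑[ y ∈ xs ] (f y + g y) ≡⟨ cong (f x + g x +_) (∑-+ xs f g) ⟩
  f x + g x + (∑ xs f + ∑ xs g)       ≡⟨ +-interchange (f x) (g x) _ _ ⟩
  f x + ∑ xs f + (g x + ∑ xs g)       ∎
  where open ≡-Reasoning

∑-*ˡ : (c : ℕ) (xs : List A) (f : A → ℕ) → ∑[ x ∈ xs ] (c * f x) ≡ c * ∑ xs f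
∑-*ˡ c []       f = sym (*-zeroʳ c)
∑-*ˡ c (x ∷ xs) f = trans (cong (c * f x +_) (∑-*ˡ c xs f)) (sym (*-distribˡ-+ c (f x) (∑ xs f)))

∑-*ʳ : (c : ℕ) (xs : List A) (f : A → ℕ) → ∑[ x ∈ xs ] (f x * c) ≡ ∑ xs f * c
∑-*ʳ c xs f = begin
  ∑[ x ∈ xs ] (f x * c) ≡⟨ ∑-cong xs (λ x → *-comm (f x) c) ⟩
  ∑[ x ∈ xs ] (c * f x) ≡⟨ ∑-*ˡ c xs f ⟩
  c * ∑ xs f            ≡⟨ *-comm c _ ⟩
  ∑ xs f * c            ∎
  where open ≡-Reasoning

∑-const : (xs : List A) (c : ℕ) → ∑[ x ∈ xs ] c ≡ length xs * c
∑-const []       c = refl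
∑-const (x ∷ xs) c = cong (c +_) (∑-const xs c)

∑-comm : (xs : List A) (ys : List B) (f : A → B → ℕ) →
         ∑[ x ∈ xs ] ∑[ y ∈ ys ] f x y ≡ ∑[ y ∈ ys ] ∑[ x ∈ xs ] f x y
∑-comm []       ys f = sym (trans (∑-const ys 0) (*-zeroʳ (length ys)))
∑-comm (x ∷ xs) ys f = begin
  ∑ ys (f x) + ∑[ x′ ∈ xs ] ∑[ y ∈ ys ] f x′ y ≡⟨ cong (∑ ys (f x) +_) (∑-comm xs ys f) ⟩
  ∑ ys (f x) + ∑[ y ∈ ys ] ∑[ x′ ∈ xs ] f x′ y ≡⟨ ∑-+ ys (f x) _ ⟨
  ∑[ y ∈ ys ] (f x y + ∑[ x′ ∈ xs ] f x′ y)   ∎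
  where open ≡-Reasoning

∑-concatMap : (g : A → List B) (xs : List A) (f : B → ℕ) →
              ∑ (concatMap g xs) f ≡ ∑[ x ∈ xs ] ∑ (g x) f
∑-concatMap g []       f = refl
∑-concatMap g (x ∷ xs) f =
  trans (∑-++ (g x) (concatMap g xs) f) (cong (∑ (g x) f +_) (∑-concatMap g xs f))

∑-cartesianProduct : (xs : List A) (ys : List B) (f : A × B → ℕ) →
                     ∑ (cartesianProduct xs ys) f ≡ ∑[ x ∈ xs ] ∑[ y ∈ ys ] f (x , y)
∑-cartesianProduct []       ys f = refl
∑-cartesianProduct (x ∷ xs) ys f = begin
  ∑ (map (x ,_) ys ++ cartesianProduct xs ys) f
    ≡⟨ ∑-++ (map (x ,_) ys) _ f ⟩
  ∑ (map (x ,_) ys) f + ∑ (cartesianProduct xs ys) f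
    ≡⟨ cong₂ _+_ (∑-map (x ,_) ys f) (∑-cartesianProduct xs ys f) ⟩
  ∑[ y ∈ ys ] f (x , y) + ∑[ x′ ∈ xs ] ∑[ y ∈ ys ] f (x′ , y) ∎
  where open ≡-Reasoning

∑-product : (xs : List A) (ys : List B) (f : A → ℕ) (g : B → ℕ) →
            ∑[ x ∈ xs ] ∑[ y ∈ ys ] (f x * g y) ≡ ∑ xs f * ∑ ys g
∑-product xs ys f g = begin
  ∑[ x ∈ xs ] ∑[ y ∈ ys ] (f x * g y) ≡⟨ ∑-cong xs (λ x → ∑-*ˡ (f x) ys g) ⟩
  ∑[ x ∈ xs ] (f x * ∑ ys g)          ≡⟨ ∑-*ʳ (∑ ys g) xs f ⟩
  ∑ xs f * ∑ ys g                     ∎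
  where open ≡-Reasoning

∑-allFuns-suc : (xs : List A) (m : ℕ) (f : (Fin (suc m) → A) → ℕ) →
                ∑ (allFuns xs (suc m)) f ≡ ∑[ a ∈ xs ] ∑[ v ∈ allFuns xs m ] f (a VF.∷ v)
∑-allFuns-suc xs m f = trans (∑-concatMap _ xs f) (∑-cong xs (λ a → ∑-map (a VF.∷_) (allFuns xs m) f))

length-allFuns : (xs : List A) (m : ℕ) → length (allFuns xs m) ≡ length xs ^ m
length-allFuns xs zero    = refl
length-allFuns xs (suc m) = begin
  length (allFuns xs (suc m))               ≡⟨ length≡∑1 (allFuns xs (suc m)) ⟩
  ∑ (allFuns xs (suc m)) (λ _ → 1)          ≡⟨ ∑-allFuns-suc xs m _ ⟩
  ∑[ a ∈ xs ] ∑[ v ∈ allFuns xs m ] 1       ≡⟨ ∑-cong xs (λ _ → length≡∑1 (allFuns xs m)) ⟨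
  ∑[ a ∈ xs ] length (allFuns xs m)         ≡⟨ ∑-const xs _ ⟩
  length xs * length (allFuns xs m)         ≡⟨ cong (length xs *_) (length-allFuns xs m) ⟩
  length xs * length xs ^ m                 ∎
  where
  open ≡-Reasoning
  length≡∑1 : (ys : List C) → length ys ≡ ∑[ y ∈ ys ] 1
  length≡∑1 ys = sym (trans (∑-const ys 1) (*-identityʳ (length ys)))

length-filterᵇ≡∑ : (p : A → Bool) (xs : List A) → length (filterᵇ p xs) ≡ ∑[ x ∈ xs ] 𝟙ᵇ (p x)
length-filterᵇ≡∑ p []       = refl
length-filterᵇ≡∑ p (x ∷ xs) with p x
... | true  = cong suc (length-filterᵇ≡∑ p xs)
... | false = length-filterᵇ≡∑ p xs

𝟙ᵇ-∧ : ∀ a b → 𝟙ᵇ (a ∧ b) ≡ 𝟙ᵇ a * 𝟙ᵇ b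
𝟙ᵇ-∧ true  b = sym (+-identityʳ (𝟙ᵇ b))
𝟙ᵇ-∧ false b = refl

𝟙-yes : (p : Dec P) → P → 𝟙 p ≡ 1
𝟙-yes p x = cong 𝟙ᵇ (dec-true p x)

𝟙-no : (p : Dec P) → ¬ P → 𝟙 p ≡ 0
𝟙-no p ¬x = cong 𝟙ᵇ (dec-false p ¬x)

𝟙-⇔ : P ⇔ Q → (p : Dec P) (q : Dec Q) → 𝟙 p ≡ 𝟙 q
𝟙-⇔ P⇔Q p q = cong 𝟙ᵇ (does-⇔ P⇔Q p q)

𝟙-× : (p : Dec P) (q : Dec Q) → 𝟙 (p ×-dec q) ≡ 𝟙 p * 𝟙 q
𝟙-× p q = 𝟙ᵇ-∧ (does p) (does q)

𝟙+𝟙-¬ : (p : Dec P) → 𝟙 p + 𝟙 (¬? p) ≡ 1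
𝟙+𝟙-¬ (yes _) = refl
𝟙+𝟙-¬ (no _)  = refl

𝟙ᵇ-∧-∧ : ∀ a b c → 𝟙ᵇ (a ∧ b ∧ c) ≡ 𝟙ᵇ (a ∧ c) * 𝟙ᵇ b
𝟙ᵇ-∧-∧ true  true  c = sym (*-identityʳ (𝟙ᵇ c))
𝟙ᵇ-∧-∧ true  false c = sym (*-zeroʳ (𝟙ᵇ c))
𝟙ᵇ-∧-∧ false b     c = refl

𝟙-*-cong : (p : Dec P) {k l : ℕ} → (P → k ≡ l) → 𝟙 p * k ≡ 𝟙 p * l
𝟙-*-cong (yes x) k≡l = cong (_+ 0) (k≡l x)
𝟙-*-cong (no _)  k≡l = refl

counting-identity : ∀ p r C N θ → 1 ≤ r → p * C + N ≡ N * r + θ * p * r →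
                    C * p ^ 2 ≡ p * N * (r ∸ 1) + θ * r * p ^ 2
counting-identity p (suc s) C N θ _ pC+N≡ = begin
  C * p ^ 2
    ≡⟨ cong (C *_) (cong (p *_) (*-identityʳ p)) ⟩
  C * (p * p)
    ≡⟨ square C p ⟩
  p * C * p
    ≡⟨ cong (_* p) pC≡ ⟩
  (N * s + θ * p * suc s) * p
    ≡⟨ distribute N s θ p ⟩
  p * N * s + θ * suc s * (p * p)
    ≡⟨ cong (λ t → p * N * s + θ * suc s * (p * t)) (*-identityʳ p) ⟨
  p * N * s + θ * suc s * p ^ 2 ∎
  where
  open ≡-Reasoning
  pC≡ : p * C ≡ N * s + θ * p * suc s
  pC≡ = +-cancelʳ-≡ N _ _ (trans pC+N≡ (split-off N s (θ * p * suc s)))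
    where
    split-off : ∀ a s t → a * suc s + t ≡ a * s + t + a
    split-off = solve-∀
  square : ∀ c p → c * (p * p) ≡ p * c * p
  square = solve-∀
  distribute : ∀ a s t p → (a * s + t * p * suc s) * p ≡ p * a * s + t * suc s * (p * p)
  distribute = solve-∀

module Enumeration {A : Set} {_∼_ : Rel A 0ℓ} (_∼?_ : Decidable _∼_) where

  -- Vectors are functions, so their enumeration allFuns is complete and unique only up to pointwise equality.
  Enumerates : List A → Set
  Enumerates xs = ∀ y → ∑[ x ∈ xs ] 𝟙 (x ∼? y) ≡ 1

  module _ (xs : List A) (enum : Enumerates xs) where

    ∑-pick : (y : A) (f : A → ℕ) → (∀ {x} → x ∼ y → f x ≡ f y) →
             ∑[ x ∈ xs ] (f x * 𝟙 (x ∼? y)) ≡ f y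
    ∑-pick y f resp = begin
      ∑[ x ∈ xs ] (f x * 𝟙 (x ∼? y)) ≡⟨ ∑-cong xs move ⟩
      ∑[ x ∈ xs ] (f y * 𝟙 (x ∼? y)) ≡⟨ ∑-*ˡ (f y) xs _ ⟩
      f y * ∑[ x ∈ xs ] 𝟙 (x ∼? y)   ≡⟨ cong (f y *_) (enum y) ⟩
      f y * 1                        ≡⟨ *-identityʳ (f y) ⟩
      f y                            ∎
      where
      open ≡-Reasoning
      move : ∀ x → f x * 𝟙 (x ∼? y) ≡ f y * 𝟙 (x ∼? y)
      move x with x ∼? y
      ... | yes x∼y = cong (_* 1) (resp x∼y)
      ... | no  _   = trans (*-zeroʳ (f x)) (sym (*-zeroʳ (f y)))

    enumerated : (y : A) → ∃ λ x → x ∈ xs × x ∼ y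
    enumerated y = search xs (λ ∑≡0 → contradiction (trans (sym (enum y)) ∑≡0) λ ())
      where
      search : (zs : List A) → ¬ (∑[ z ∈ zs ] 𝟙 (z ∼? y) ≡ 0) → ∃ λ x → x ∈ zs × x ∼ y
      search []       ∑≢0 = contradiction refl ∑≢0
      search (z ∷ zs) ∑≢0 with z ∼? y
      ... | yes z∼y = z , here refl , z∼y
      ... | no  _   with search zs ∑≢0
      ...   | x , x∈zs , x∼y = x , there x∈zs , x∼y

    ∑-unique : {T : A → Set} (T? : ∀ a → Dec (T a)) (a₀ : A) → (∀ a → T a ⇔ a ∼ a₀) →
               ∑[ a ∈ xs ] 𝟙 (T? a) ≡ 1
    ∑-unique T? a₀ T⇔∼ = trans (∑-cong xs (λ a → 𝟙-⇔ (T⇔∼ a) (T? a) (a ∼? a₀))) (enum a₀)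

    ∑-fibres : (as : List C) (w : C → ℕ) (φ : C → A) (P : A → ℕ) → P Preserves _∼_ ⟶ _≡_ →
               ∑[ b ∈ xs ] (∑[ a ∈ as ] (w a * 𝟙 (b ∼? φ a)) * P b) ≡
               ∑[ a ∈ as ] (w a * P (φ a))
    ∑-fibres as w φ P resp = begin
      ∑[ b ∈ xs ] (∑[ a ∈ as ] (w a * 𝟙 (b ∼? φ a)) * P b)
        ≡⟨ ∑-cong xs (λ b → ∑-*ʳ (P b) as _) ⟨
      ∑[ b ∈ xs ] ∑[ a ∈ as ] (w a * 𝟙 (b ∼? φ a) * P b)
        ≡⟨ ∑-comm xs as _ ⟩
      ∑[ a ∈ as ] ∑[ b ∈ xs ] (w a * 𝟙 (b ∼? φ a) * P b)
        ≡⟨ ∑-cong as (λ a → ∑-cong xs (λ b → rearrange (w a) _ (P b))) ⟩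
      ∑[ a ∈ as ] ∑[ b ∈ xs ] (w a * (P b * 𝟙 (b ∼? φ a)))
        ≡⟨ ∑-cong as (λ a → ∑-*ˡ (w a) xs _) ⟩
      ∑[ a ∈ as ] (w a * ∑[ b ∈ xs ] (P b * 𝟙 (b ∼? φ a)))
        ≡⟨ ∑-cong as (λ a → cong (w a *_) (∑-pick (φ a) P resp)) ⟩
      ∑[ a ∈ as ] (w a * P (φ a)) ∎
      where
      open ≡-Reasoning
      rearrange : ∀ x y z → x * y * z ≡ x * (z * y)
      rearrange = solve-∀

    ∑-reindex : (f : A → ℕ) → f Preserves _∼_ ⟶ _≡_ → (g h : A → A) →
                (∀ u v → u ∼ g v ⇔ v ∼ h u) → ∑[ v ∈ xs ] f (g v) ≡ ∑ xs f
    ∑-reindex f resp g h inverse = begin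
      ∑[ v ∈ xs ] f (g v)
        ≡⟨ ∑-cong xs (λ v → ∑-pick (g v) f resp) ⟨
      ∑[ v ∈ xs ] ∑[ u ∈ xs ] (f u * 𝟙 (u ∼? g v))
        ≡⟨ ∑-comm xs xs _ ⟩
      ∑[ u ∈ xs ] ∑[ v ∈ xs ] (f u * 𝟙 (u ∼? g v))
        ≡⟨ ∑-cong xs (λ u → ∑-*ˡ (f u) xs _) ⟩
      ∑[ u ∈ xs ] (f u * ∑[ v ∈ xs ] 𝟙 (u ∼? g v))
        ≡⟨ ∑-cong xs (λ u → cong (f u *_) (preimage u)) ⟩
      ∑[ u ∈ xs ] (f u * 1)
        ≡⟨ ∑-cong xs (λ u → *-identityʳ (f u)) ⟩
      ∑ xs f ∎
      where
      open ≡-Reasoning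
      preimage : ∀ u → ∑[ v ∈ xs ] 𝟙 (u ∼? g v) ≡ 1
      preimage u = ∑-unique (λ v → u ∼? g v) (h u) (inverse u)

module _ {A : Set} (_≟_ : DecidableEquality A) where
  open Enumeration _≟_

  unique-complete⇒enumerates : {xs : List A} → Unique xs → (∀ y → y ∈ xs) → Enumerates xs
  unique-complete⇒enumerates unique complete y = go unique (complete y)
    where
    go : {zs : List A} → Unique zs → y ∈ zs → ∑[ z ∈ zs ] 𝟙 (z ≟ y) ≡ 1
    go {z ∷ zs} (z∉zs ∷ _) (here refl) = cong₂ _+_ (𝟙-yes (z ≟ z) refl)
      (∑-zero zs (λ z′ z′∈zs → 𝟙-no (z′ ≟ z) (λ z′≡z → All.lookup z∉zs z′∈zs (sym z′≡z))))
    go {z ∷ zs} (z∉zs ∷ u) (there y∈zs) =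
      cong₂ _+_ (𝟙-no (z ≟ y) (λ { refl → All.lookup z∉zs y∈zs refl })) (go u y∈zs)

module _ {A B : Set} {R : Rel A 0ℓ} {S : Rel B 0ℓ} (R? : Decidable R) (S? : Decidable S) where
  open Enumeration

  cartesianProduct-enumerates : (xs : List A) (ys : List B) → Enumerates R? xs → Enumerates S? ys →
                                Enumerates (×.×-decidable R? S?) (cartesianProduct xs ys)
  cartesianProduct-enumerates xs ys enumˣ enumʸ (a , b) = begin
    ∑ (cartesianProduct xs ys) (λ p → 𝟙 (×.×-decidable R? S? p (a , b)))
      ≡⟨ ∑-cartesianProduct xs ys _ ⟩
    ∑[ x ∈ xs ] ∑[ y ∈ ys ] 𝟙 (R? x a ×-dec S? y b)
      ≡⟨ ∑-cong xs (λ x → ∑-cong ys (λ y → 𝟙-× (R? x a) (S? y b))) ⟩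
    ∑[ x ∈ xs ] ∑[ y ∈ ys ] (𝟙 (R? x a) * 𝟙 (S? y b))
      ≡⟨ ∑-product xs ys _ _ ⟩
    ∑[ x ∈ xs ] 𝟙 (R? x a) * ∑[ y ∈ ys ] 𝟙 (S? y b)
      ≡⟨ cong₂ _*_ (enumˣ a) (enumʸ b) ⟩
    1 ∎
    where open ≡-Reasoning

module _ {A : Set} {R : Rel A 0ℓ} (R? : Decidable R) where
  open Enumeration

  allFuns-enumerates : (xs : List A) → Enumerates R? xs → ∀ m →
                       Enumerates (Pointwise.decidable R?) (allFuns xs m)
  allFuns-enumerates xs enum zero    w = cong (_+ 0) (𝟙-yes (Pointwise.decidable R? (λ ()) w) (λ ()))
  allFuns-enumerates xs enum (suc m) w = begin
    ∑ (allFuns xs (suc m)) (λ v → 𝟙 (v ≋? w))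
      ≡⟨ ∑-allFuns-suc xs m _ ⟩
    ∑[ a ∈ xs ] ∑[ v ∈ allFuns xs m ] 𝟙 ((a VF.∷ v) ≋? w)
      ≡⟨ ∑-cong xs (λ a → ∑-cong (allFuns xs m) (λ v → split a v)) ⟩
    ∑[ a ∈ xs ] ∑[ v ∈ allFuns xs m ] (𝟙 (R? a (VF.head w)) * 𝟙 (v ≋? VF.tail w))
      ≡⟨ ∑-product xs (allFuns xs m) _ _ ⟩
    ∑[ a ∈ xs ] 𝟙 (R? a (VF.head w)) * ∑[ v ∈ allFuns xs m ] 𝟙 (v ≋? VF.tail w)
      ≡⟨ cong₂ _*_ (enum (VF.head w)) (allFuns-enumerates xs enum m (VF.tail w)) ⟩
    1 ∎
    where
    open ≡-Reasoning
    _≋?_ : ∀ {k} → Decidable (Pointwise R {k})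
    _≋?_ = Pointwise.decidable R?
    cons⇔ : ∀ a v → Pointwise R (a VF.∷ v) w ⇔ (R a (VF.head w) × Pointwise R v (VF.tail w))
    cons⇔ a v = mk⇔ (λ r → r zero , r ∘ suc) (λ { (r₀ , rs) zero → r₀ ; (r₀ , rs) (suc i) → rs i })
    split : ∀ a v → 𝟙 ((a VF.∷ v) ≋? w) ≡ 𝟙 (R? a (VF.head w)) * 𝟙 (v ≋? VF.tail w)
    split a v = trans (𝟙-⇔ (cons⇔ a v) ((a VF.∷ v) ≋? w) (R? a (VF.head w) ×-dec (v ≋? VF.tail w)))
                      (𝟙-× (R? a (VF.head w)) (v ≋? VF.tail w))

module Counting (F : FiniteField) where

  private module F = FiniteField F
  open F using (Carrier; 0#; 1#; _≟_; _⁻¹; elements; order)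
  open LinAlg F
  open LinearAlgebra F
  open Enumeration
  open ≡-Reasoning

  elements-enumerates : Enumerates _≟_ elements
  elements-enumerates = unique-complete⇒enumerates _≟_ F.unique F.complete

  allVects-enumerates : ∀ m → Enumerates _≈?_ (allVects m)
  allVects-enumerates = allFuns-enumerates _≟_ elements elements-enumerates

  allMats-enumerates : ∀ m → Enumerates _≈ₘ?_ (allMats m)
  allMats-enumerates m = allFuns-enumerates _≈?_ (allVects m) (allVects-enumerates m) m

  length-allVects : ∀ m → length (allVects m) ≡ order ^ m
  length-allVects = length-allFuns elements

  nonzeros : ℕ
  nonzeros = ∑[ c ∈ elements ] 𝟙 (¬? (c ≟ 0#))

  order≡1+nonzeros : order ≡ suc nonzeros
  order≡1+nonzeros = begin
    order                                               ≡⟨ trans (∑-const elements 1) (*-identityʳ order) ⟨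
    ∑[ c ∈ elements ] 1                                 ≡⟨ ∑-cong elements (λ c → 𝟙+𝟙-¬ (c ≟ 0#)) ⟨
    ∑[ c ∈ elements ] (𝟙 (c ≟ 0#) + 𝟙 (¬? (c ≟ 0#)))    ≡⟨ ∑-+ elements _ _ ⟩
    ∑[ c ∈ elements ] 𝟙 (c ≟ 0#) + nonzeros             ≡⟨ cong (_+ nonzeros) (elements-enumerates 0#) ⟩
    suc nonzeros                                        ∎

  order-*-cancelˡ : ∀ {a b} → order * a ≡ order * b → a ≡ b
  order-*-cancelˡ {a} {b} =
    *-cancelˡ-≡ a b (suc nonzeros) ∘ subst (λ q → q * a ≡ q * b) order≡1+nonzeros

  order^n>0 : ∀ n → 0 < order ^ n
  order^n>0 n = subst (λ q → 0 < q ^ n) (sym order≡1+nonzeros) (m^n>0 (suc nonzeros) n)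

  module _ {m : ℕ} where

    V : List (Vect m)
    V = allVects m

    ∑-translate : (f : Vect m → ℕ) → f Preserves _≈_ ⟶ _≡_ → (w : Vect m) →
                  ∑[ v ∈ V ] f (v +ᵥ w) ≡ ∑ V f
    ∑-translate f resp w =
      ∑-reindex _≈?_ V (allVects-enumerates m) f resp (_+ᵥ w) (_+ᵥ (-ᵥ w)) (λ _ _ → +ᵥ-transpose)

    -- Translation by the w of the hypothesis carries the fibre of L over 0 onto the fibre over c.
    ∑-fibre : (W : Vect m → ℕ) (L : Vect m → Carrier) →
              W Preserves _≈_ ⟶ _≡_ → L Preserves _≈_ ⟶ _≡_ →
              (∀ c → ∃ λ w → (∀ v → W (v +ᵥ w) ≡ W v) × (∀ v → L (v +ᵥ w) ≡ L v F.+ c)) →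
              ∑ V W ≡ order * ∑[ v ∈ V ] (W v * 𝟙 (L v ≟ 0#))
    ∑-fibre W L W-resp L-resp shift = begin
      ∑ V W
        ≡⟨ ∑-cong V (λ v → trans (cong (W v *_) (elements-enumerates (L v))) (*-identityʳ (W v))) ⟨
      ∑[ v ∈ V ] (W v * ∑[ c ∈ elements ] 𝟙 (c ≟ L v))
        ≡⟨ ∑-cong V (λ v → ∑-*ˡ (W v) elements _) ⟨
      ∑[ v ∈ V ] ∑[ c ∈ elements ] (W v * 𝟙 (c ≟ L v))
        ≡⟨ ∑-comm V elements _ ⟩
      ∑[ c ∈ elements ] ∑[ v ∈ V ] (W v * 𝟙 (c ≟ L v))
        ≡⟨ ∑-cong elements fibre ⟩
      ∑[ c ∈ elements ] K
        ≡⟨ ∑-const elements K ⟩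
      order * K ∎
      where
      K = ∑[ v ∈ V ] (W v * 𝟙 (L v ≟ 0#))
      fibre : ∀ c → ∑[ v ∈ V ] (W v * 𝟙 (c ≟ L v)) ≡ K
      fibre c with shift c
      ... | w , W-shift , L-shift = begin
        ∑[ v ∈ V ] (W v * 𝟙 (c ≟ L v))
          ≡⟨ ∑-translate _ (λ u≈v → cong₂ _*_ (W-resp u≈v) (cong (λ a → 𝟙 (c ≟ a)) (L-resp u≈v))) w ⟨
        ∑[ v ∈ V ] (W (v +ᵥ w) * 𝟙 (c ≟ L (v +ᵥ w)))
          ≡⟨ ∑-cong V (λ v → cong₂ _*_ (W-shift v) (𝟙-⇔ (c≡L+c⇔ v) (c ≟ L (v +ᵥ w)) (L v ≟ 0#))) ⟩
        K ∎
        where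
        c≡L+c⇔ : ∀ v → c ≡ L (v +ᵥ w) ⇔ L v ≡ 0#
        c≡L+c⇔ v = subst (λ a → c ≡ a ⇔ L v ≡ 0#) (sym (L-shift v)) x≡y+x⇔y≡0

    ∑-split-0 : (P : Vect m → ℕ) → P Preserves _≈_ ⟶ _≡_ →
                ∑ V P ≡ ∑[ x ∈ V ] (𝟙 (x ≉? 0ᵥ) * P x) + P 0ᵥ
    ∑-split-0 P resp = begin
      ∑ V P
        ≡⟨ ∑-cong V (λ x → trans (cong (_* P x) (split x)) (*-identityˡ (P x))) ⟨
      ∑[ x ∈ V ] ((𝟙 (x ≉? 0ᵥ) + 𝟙 (x ≈? 0ᵥ)) * P x)
        ≡⟨ ∑-cong V (λ x → *-distribʳ-+ (P x) (𝟙 (x ≉? 0ᵥ)) (𝟙 (x ≈? 0ᵥ))) ⟩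
      ∑[ x ∈ V ] (𝟙 (x ≉? 0ᵥ) * P x + 𝟙 (x ≈? 0ᵥ) * P x)
        ≡⟨ ∑-+ V (λ x → 𝟙 (x ≉? 0ᵥ) * P x) (λ x → 𝟙 (x ≈? 0ᵥ) * P x) ⟩
      ∑[ x ∈ V ] (𝟙 (x ≉? 0ᵥ) * P x) + ∑[ x ∈ V ] (𝟙 (x ≈? 0ᵥ) * P x)
        ≡⟨ cong (∑[ x ∈ V ] (𝟙 (x ≉? 0ᵥ) * P x) +_) at-0 ⟩
      ∑[ x ∈ V ] (𝟙 (x ≉? 0ᵥ) * P x) + P 0ᵥ ∎
      where
      split : ∀ x → 𝟙 (x ≉? 0ᵥ) + 𝟙 (x ≈? 0ᵥ) ≡ 1
      split x = trans (+-comm (𝟙 (x ≉? 0ᵥ)) (𝟙 (x ≈? 0ᵥ))) (𝟙+𝟙-¬ (x ≈? 0ᵥ))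
      at-0 : ∑[ x ∈ V ] (𝟙 (x ≈? 0ᵥ) * P x) ≡ P 0ᵥ
      at-0 = trans (∑-cong V (λ x → *-comm (𝟙 (x ≈? 0ᵥ)) (P x)))
                   (∑-pick _≈?_ V (allVects-enumerates m) 0ᵥ P resp)

    scalings : List (Carrier × Vect m)
    scalings = cartesianProduct elements V

    scale : Carrier × Vect m → Vect m
    scale (c , y) = c ·ᵥ y

    normalisedScaling? : (a : Carrier × Vect m) → Dec (proj₁ a ≢ 0# × T (normalisedV (proj₂ a)))
    normalisedScaling? (c , y) = ¬? (c ≟ 0#) ×-dec T? (normalisedV y)

    ∑-normalisedScalings : ∀ x →
      ∑[ a ∈ scalings ] (𝟙 (normalisedScaling? a) * 𝟙 (x ≈? scale a)) ≡ 𝟙 (x ≉? 0ᵥ)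
    ∑-normalisedScalings x =
      trans (∑-cong scalings (λ a → sym (𝟙-× (normalisedScaling? a) (x ≈? scale a)))) (count (x ≈? 0ᵥ))
      where
      count : (x≈?0 : Dec (x ≈ 0ᵥ)) →
              ∑[ a ∈ scalings ] 𝟙 (normalisedScaling? a ×-dec x ≈? scale a) ≡ 𝟙 (¬? x≈?0)
      count (yes x≈0) = ∑-zero scalings λ (c , y) _ → 𝟙-no (normalisedScaling? (c , y) ×-dec x ≈? c ·ᵥ y)
        λ ((c≢0 , ny) , x≈cy) →
          lead≡just⇒≉0 (trans (lead-cong x≈cy) (lead-·ᵥ-normalised y c≢0 (isOneM-sound ny))) x≈0
      count (no x≉0) = let a , lx≡a = nonzero⇒lead x≉0 in
        ∑-unique (×.×-decidable _≟_ _≈?_) scalings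
          (cartesianProduct-enumerates _≟_ _≈?_ elements V elements-enumerates (allVects-enumerates m))
          (λ a → normalisedScaling? a ×-dec x ≈? scale a) (a , a ⁻¹ ·ᵥ x) (λ _ → ·ᵥ-normalised⇔ lx≡a)

    ∑-nonzero : (P : Vect m → ℕ) → P Preserves _≈_ ⟶ _≡_ → (∀ c y → c ≢ 0# → P (c ·ᵥ y) ≡ P y) →
                ∑[ x ∈ V ] (𝟙 (x ≉? 0ᵥ) * P x) ≡ nonzeros * ∑[ y ∈ V ] (𝟙ᵇ (normalisedV y) * P y)
    ∑-nonzero P resp P-scale = begin
      ∑[ x ∈ V ] (𝟙 (x ≉? 0ᵥ) * P x)
        ≡⟨ ∑-cong V (λ x → cong (_* P x) (∑-normalisedScalings x)) ⟨
      ∑[ x ∈ V ] (∑[ a ∈ scalings ] (𝟙 (normalisedScaling? a) * 𝟙 (x ≈? scale a)) * P x)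
        ≡⟨ ∑-fibres _≈?_ V (allVects-enumerates m) scalings (𝟙 ∘ normalisedScaling?) scale P resp ⟩
      ∑[ a ∈ scalings ] (𝟙 (normalisedScaling? a) * P (scale a))
        ≡⟨ ∑-cartesianProduct elements V _ ⟩
      ∑[ c ∈ elements ] ∑[ y ∈ V ] (𝟙 (normalisedScaling? (c , y)) * P (c ·ᵥ y))
        ≡⟨ ∑-cong elements (λ c → ∑-cong V (λ y → term c y)) ⟩
      ∑[ c ∈ elements ] ∑[ y ∈ V ] (𝟙 (¬? (c ≟ 0#)) * (𝟙ᵇ (normalisedV y) * P y))
        ≡⟨ ∑-product elements V _ _ ⟩
      nonzeros * ∑[ y ∈ V ] (𝟙ᵇ (normalisedV y) * P y) ∎
      where
      term : ∀ c y → 𝟙 (normalisedScaling? (c , y)) * P (c ·ᵥ y) ≡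
                     𝟙 (¬? (c ≟ 0#)) * (𝟙ᵇ (normalisedV y) * P y)
      term c y = begin
        𝟙 (¬? (c ≟ 0#) ×-dec T? (normalisedV y)) * P (c ·ᵥ y)
          ≡⟨ cong (_* P (c ·ᵥ y)) (𝟙-× (¬? (c ≟ 0#)) (T? (normalisedV y))) ⟩
        𝟙 (¬? (c ≟ 0#)) * 𝟙ᵇ (normalisedV y) * P (c ·ᵥ y)
          ≡⟨ *-assoc (𝟙 (¬? (c ≟ 0#))) _ _ ⟩
        𝟙 (¬? (c ≟ 0#)) * (𝟙ᵇ (normalisedV y) * P (c ·ᵥ y))
          ≡⟨ 𝟙-*-cong (¬? (c ≟ 0#)) (cong (𝟙ᵇ (normalisedV y) *_) ∘ P-scale c y) ⟩
        𝟙 (¬? (c ≟ 0#)) * (𝟙ᵇ (normalisedV y) * P y) ∎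

    ∑-projective : (P : Vect m → ℕ) → P Preserves _≈_ ⟶ _≡_ → (∀ c y → c ≢ 0# → P (c ·ᵥ y) ≡ P y) →
                   ∑ V P ≡ nonzeros * ∑[ y ∈ V ] (𝟙ᵇ (normalisedV y) * P y) + P 0ᵥ
    ∑-projective P resp P-scale = trans (∑-split-0 P resp) (cong (_+ P 0ᵥ) (∑-nonzero P resp P-scale))

  count-kernel : ∀ {n} (ξ : Vect (suc n)) k → ξ k ≢ 0# →
                 ∑[ x ∈ allVects (suc n) ] 𝟙 (apply ξ x ≟ 0#) ≡ order ^ n
  count-kernel {n} ξ k ξk≢0 = sym (order-*-cancelˡ (begin
    order * order ^ n
      ≡⟨ length-allVects (suc n) ⟨
    length (allVects (suc n))
      ≡⟨ trans (∑-const (allVects (suc n)) 1) (*-identityʳ _) ⟨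
    ∑[ x ∈ allVects (suc n) ] 1
      ≡⟨ ∑-fibre (λ _ → 1) (apply ξ) (λ _ → refl) (apply-congʳ ξ) shift ⟩
    order * ∑[ x ∈ allVects (suc n) ] (1 * 𝟙 (apply ξ x ≟ 0#))
      ≡⟨ cong (order *_) (∑-cong (allVects (suc n)) (λ x → *-identityˡ _)) ⟩
    order * ∑[ x ∈ allVects (suc n) ] 𝟙 (apply ξ x ≟ 0#) ∎))
    where
    shift : ∀ c → ∃ λ w → (∀ v → 1 ≡ 1) × (∀ v → apply ξ (v +ᵥ w) ≡ apply ξ v F.+ c)
    shift c = (c F.* ξ k ⁻¹) ·ᵥ unit k , (λ _ → refl) , apply-shift-unit ξ k ξk≢0 c

module Incidence (F : FiniteField) (Aut : FieldAut F) where

  private module F = FiniteField F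
  open F using (Carrier; 0#; 1#; _≟_; _⁻¹; elements; order)
  open FieldAut Aut using (σ; σ-1; injective)
  open LinAlg F
  open LinearAlgebra F
  open Semilinear Aut
  private module R = CommutativeRing commutativeRing
  open Paper F Aut
  open Counting F hiding (V)
  open Enumeration
  open ≡-Reasoning

  module _ {m : ℕ} (M : Mat m) (ξ : Vect m) where

    private
      V : List (Vect m)
      V = allVects m

    kerCond-sound : T (kerCond M ξ) → ∀ y → apply (vmap σ ξ) y ≡ 0# → apply (rowMul ξ M) y ≡ 0#
    kerCond-sound t y ξσy≡0 with enumerated _≈?_ V (allVects-enumerates m) y
    ... | y′ , y′∈V , y′≈y with All.lookup (all⁺ _ V t) y′∈V
    ...   | holds with isZero (apply (vmap σ ξ) y′)
                     | does-complete (apply (vmap σ ξ) y′ ≟ 0#) (trans (apply-congʳ _ y′≈y) ξσy≡0)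
    ...     | true | _ = trans (apply-congʳ _ (≈-sym y′≈y)) (does-sound (apply (rowMul ξ M) y′ ≟ 0#) holds)

    kerCond-witness : ¬ T (kerCond M ξ) → ∃ λ y → apply (vmap σ ξ) y ≡ 0# × apply (rowMul ξ M) y ≢ 0#
    kerCond-witness ¬t with find (¬All⇒Any¬ (λ _ → T? _) V (¬t ∘ all⁻ _))
    ... | y , _ , fails with apply (vmap σ ξ) y ≟ 0# | apply (rowMul ξ M) y ≟ 0#
    ...   | yes ξσy≡0 | no ξMy≢0 = y , ξσy≡0 , ξMy≢0
    ...   | yes _     | yes _    = contradiction _ fails
    ...   | no  _     | _        = contradiction _ fails

  module _ {m : ℕ} where

    private
      V : List (Vect m)
      V = allVects m

    InΛ : Mat m → Set
    InΛ X = ∃ λ c → ∃ λ y → ∃ λ η →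
            c ≢ 0# × ¬ (y ≈ 0ᵥ) × ¬ (η ≈ 0ᵥ) × apply η y ≡ 0# × X ≈ₘ outer c (vmap σ y) η

    inΛ-sound : ∀ {X} → T (inΛ X) → InΛ X
    inΛ-sound t =
      let c , _ , t₁   = find (any⁻ _ elements t)
          c≉0 , t₂     = Equivalence.to T-∧ t₁
          y , _ , t₃   = find (any⁻ _ V t₂)
          y≉0 , t₄     = Equivalence.to T-∧ t₃
          η , _ , t₅   = find (any⁻ _ V t₄)
          η≉0 , t₆     = Equivalence.to T-∧ t₅
          ηy≡0 , X≈cyη = Equivalence.to T-∧ t₆
      in c , y , η ,
         T-not-sound c≉0 ∘ does-complete (c ≟ 0#) ,
         T-not-sound y≉0 ∘ vecIsZero-complete ,
         T-not-sound η≉0 ∘ vecIsZero-complete ,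
         does-sound (apply η y ≟ 0#) ηy≡0 ,
         matEq-sound X≈cyη

    inΛ-complete : ∀ {X c y η} → y ∈ V → η ∈ V → c ≢ 0# → ¬ (y ≈ 0ᵥ) → ¬ (η ≈ 0ᵥ) →
                   apply η y ≡ 0# → X ≈ₘ outer c (vmap σ y) η → T (inΛ X)
    inΛ-complete {X} {c} {y} {η} y∈V η∈V c≢0 y≉0 η≉0 ηy≡0 X≈cyη =
      any⁺ _ (lose (F.complete c) (Equivalence.from T-∧ (T-not-complete (c≢0 ∘ does-sound (c ≟ 0#)) ,
      any⁺ _ (lose y∈V (Equivalence.from T-∧ (T-not-complete (y≉0 ∘ vecIsZero-sound) ,
      any⁺ _ (lose η∈V (Equivalence.from T-∧ (T-not-complete (η≉0 ∘ vecIsZero-sound) ,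
      Equivalence.from T-∧ (does-complete (apply η y ≟ 0#) ηy≡0 , matEq-complete X≈cyη))))))))))

    flags : List (Vect m × Vect m)
    flags = cartesianProduct V V

    IsFlag : Vect m × Vect m → Set
    IsFlag (ξ , x) = (T (normalisedV ξ) × T (normalisedV x)) × apply ξ x ≡ 0#

    isFlag? : (a : Vect m × Vect m) → Dec (IsFlag a)
    isFlag? (ξ , x) = (T? (normalisedV ξ) ×-dec T? (normalisedV x)) ×-dec apply ξ x ≟ 0#

    rankOne : Vect m × Vect m → Mat m
    rankOne (ξ , x) = outer 1# (vmap σ x) ξ

    flags-enumerates : Enumerates (×.×-decidable _≈?_ _≈?_) flags
    flags-enumerates = cartesianProduct-enumerates _≈?_ _≈?_ V V (allVects-enumerates m) (allVects-enumerates m)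

    IsFlag-resp : ∀ {a b} → ×.Pointwise _≈_ _≈_ a b → IsFlag a → IsFlag b
    IsFlag-resp (ξ≈ξ′ , x≈x′) ((nξ , nx) , ξx≡0) =
      (subst (T ∘ isOneM) (lead-cong ξ≈ξ′) nξ , subst (T ∘ isOneM) (lead-cong x≈x′) nx) ,
      trans (sym (apply-cong ξ≈ξ′ x≈x′)) ξx≡0

    rankOne-cong : ∀ {a b} → ×.Pointwise _≈_ _≈_ a b → rankOne a ≈ₘ rankOne b
    rankOne-cong (ξ≈ξ′ , x≈x′) i j = cong (1# F.*_) (cong₂ F._*_ (cong σ (x≈x′ i)) (ξ≈ξ′ j))

    lead-vmap-normalised : (x : Vect m) → T (normalisedV x) → lead (vmap σ x) ≡ just 1#
    lead-vmap-normalised x t = begin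
      lead (vmap σ x)            ≡⟨ lead-vmap x ⟩
      Maybe.map σ (lead x)       ≡⟨ cong (Maybe.map σ) (normalised-lead x t) ⟩
      just (σ 1#)                ≡⟨ cong just σ-1 ⟩
      just 1#                    ∎

    rankOne-injective : ∀ {a b} → IsFlag a → IsFlag b → rankOne a ≈ₘ rankOne b → ×.Pointwise _≈_ _≈_ a b
    rankOne-injective {ξ , x} {ξ′ , x′} ((nξ , nx) , _) ((nξ′ , nx′) , _) a≈b =
      let σx≈σx′ , ξ≈ξ′ = outer-injective (lead-vmap-normalised x nx) (lead-vmap-normalised x′ nx′)
                                          (normalised-lead ξ nξ) (normalised-lead ξ′ nξ′)
                                          (λ i j → *-cancelˡ 1# 1≢0 (a≈b i j))
      in ξ≈ξ′ , λ i → injective (x i) (x′ i) (σx≈σx′ i)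

    flag⇒Λ-point : ∀ {X ξ x} → ξ ∈ V → x ∈ V → IsFlag (ξ , x) → X ≈ₘ rankOne (ξ , x) →
                   T (normalisedM X ∧ inΛ X)
    flag⇒Λ-point {X} {ξ} {x} ξ∈V x∈V ((nξ , nx) , ξx≡0) X≈ξx = Equivalence.from T-∧ (normalised , inΛX)
      where
      normalised : T (normalisedM X)
      normalised = isOneM-complete (begin
        leadRows X
          ≡⟨ leadRows-cong X≈ξx ⟩
        leadRows (rankOne (ξ , x))
          ≡⟨ leadRows-outer 1# (vmap σ x) ξ 1≢0 (lead-vmap-normalised x nx) (normalised-lead ξ nξ) ⟩
        just (1# F.* 1# F.* 1#)
          ≡⟨ cong just (trans (R.*-identityʳ (1# F.* 1#)) (R.*-identityʳ 1#)) ⟩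
        just 1# ∎)
      inΛX : T (inΛ X)
      inΛX = inΛ-complete x∈V ξ∈V 1≢0 (normalised⇒≉0 nx) (normalised⇒≉0 nξ) ξx≡0 X≈ξx

    -- Writing X = c y^σ η, normalise y by its leading entry a and absorb c σ(a) into η; the
    -- normalisation of X is what makes the new row vector normalised.
    Λ-point⇒flag : ∀ {X} → T (normalisedM X ∧ inΛ X) → ∃ λ a → IsFlag a × X ≈ₘ rankOne a
    Λ-point⇒flag {X} t with Equivalence.to T-∧ t
    ... | normX , inΛX with inΛ-sound inΛX
    ... | c , y , η , c≢0 , y≉0 , η≉0 , ηy≡0 , X≈cyη with nonzero⇒lead y≉0 | nonzero⇒lead η≉0
    ... | a , ly≡a | b , lη≡b =
      (ξ , x) , ((nξ , nx) , ξx≡0) , λ i j → trans (X≈cyη i j) (outer-rescale c y η a≢0 i j)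
      where
      a≢0 = lead-≢0 {v = y} ly≡a
      x = a ⁻¹ ·ᵥ y
      ξ = (c F.* σ a) ·ᵥ η
      cσa≢0 : c F.* σ a ≢ 0#
      cσa≢0 = *-≢0 c≢0 (σ-≢0 a≢0)
      cσab≡1 : just (c F.* σ a F.* b) ≡ just 1#
      cσab≡1 = begin
        just (c F.* σ a F.* b)
          ≡⟨ leadRows-outer c (vmap σ y) η c≢0 (trans (lead-vmap y) (cong (Maybe.map σ) ly≡a)) lη≡b ⟨
        leadRows (outer c (vmap σ y) η)
          ≡⟨ leadRows-cong X≈cyη ⟨
        leadRows X
          ≡⟨ isOneM-sound normX ⟩
        just 1# ∎
      nξ : T (normalisedV ξ)
      nξ = isOneM-complete (begin
        lead ξ                              ≡⟨ lead-·ᵥ η cσa≢0 ⟩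
        Maybe.map (c F.* σ a F.*_) (lead η) ≡⟨ cong (Maybe.map (c F.* σ a F.*_)) lη≡b ⟩
        just (c F.* σ a F.* b)              ≡⟨ cσab≡1 ⟩
        just 1#                             ∎)
      nx : T (normalisedV x)
      nx = isOneM-complete (lead-normalise y ly≡a)
      ξx≡0 : apply ξ x ≡ 0#
      ξx≡0 = begin
        apply ξ x                     ≡⟨ apply-·ˡ (c F.* σ a) η x ⟩
        c F.* σ a F.* apply η x       ≡⟨ cong (c F.* σ a F.*_) (apply-·ʳ (a ⁻¹) η y) ⟩
        c F.* σ a F.* (a ⁻¹ F.* apply η y) ≡⟨ cong (λ t → c F.* σ a F.* (a ⁻¹ F.* t)) ηy≡0 ⟩
        c F.* σ a F.* (a ⁻¹ F.* 0#)   ≡⟨ cong (c F.* σ a F.*_) (R.zeroʳ (a ⁻¹)) ⟩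
        c F.* σ a F.* 0#              ≡⟨ R.zeroʳ _ ⟩
        0#                            ∎

    ∑-flags : ∀ X → ∑[ a ∈ flags ] (𝟙 (isFlag? a) * 𝟙 (X ≈ₘ? rankOne a)) ≡ 𝟙ᵇ (normalisedM X ∧ inΛ X)
    ∑-flags X = trans (∑-cong flags (λ a → sym (𝟙-× (isFlag? a) (X ≈ₘ? rankOne a))))
                      (count (T? (normalisedM X ∧ inΛ X)))
      where
      count : (Λ? : Dec (T (normalisedM X ∧ inΛ X))) →
              ∑[ a ∈ flags ] 𝟙 (isFlag? a ×-dec X ≈ₘ? rankOne a) ≡ 𝟙 Λ?
      count (no ¬Λ) = ∑-zero flags λ (ξ , x) a∈flags → 𝟙-no (isFlag? (ξ , x) ×-dec X ≈ₘ? rankOne (ξ , x))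
        λ (flag , X≈ξx) → let ξ∈V , x∈V = ∈-cartesianProduct⁻ V V a∈flags in
                          ¬Λ (flag⇒Λ-point ξ∈V x∈V flag X≈ξx)
      count (yes Λ) = let a₀ , flag₀ , X≈a₀ = Λ-point⇒flag Λ in
        ∑-unique (×.×-decidable _≈?_ _≈?_) flags flags-enumerates
                 (λ a → isFlag? a ×-dec X ≈ₘ? rankOne a) a₀ λ a → mk⇔
          (λ (flag , X≈a) → rankOne-injective flag flag₀ (≈ₘ-trans (≈ₘ-sym X≈a) X≈a₀))
          (λ (ξ≈ξ₀ , x≈x₀) → IsFlag-resp (≈-sym ξ≈ξ₀ , ≈-sym x≈x₀) flag₀ ,
                             ≈ₘ-trans X≈a₀ (rankOne-cong (≈-sym ξ≈ξ₀ , ≈-sym x≈x₀)))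

    countPerpΛ≡∑flags : (M : Mat m) →
                        countPerpΛ M ≡ ∑[ a ∈ flags ] (𝟙 (isFlag? a) * 𝟙ᵇ (inPerp M (rankOne a)))
    countPerpΛ≡∑flags M = begin
      countPerpΛ M
        ≡⟨ length-filterᵇ≡∑ _ (allMats m) ⟩
      ∑[ X ∈ allMats m ] 𝟙ᵇ (normalisedM X ∧ inPerp M X ∧ inΛ X)
        ≡⟨ ∑-cong (allMats m) (λ X → 𝟙ᵇ-∧-∧ (normalisedM X) (inPerp M X) (inΛ X)) ⟩
      ∑[ X ∈ allMats m ] (𝟙ᵇ (normalisedM X ∧ inΛ X) * 𝟙ᵇ (inPerp M X))
        ≡⟨ ∑-cong (allMats m) (λ X → cong (_* 𝟙ᵇ (inPerp M X)) (∑-flags X)) ⟨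
      ∑[ X ∈ allMats m ] (∑[ a ∈ flags ] (𝟙 (isFlag? a) * 𝟙 (X ≈ₘ? rankOne a)) * 𝟙ᵇ (inPerp M X))
        ≡⟨ ∑-fibres _≈ₘ?_ (allMats m) (allMats-enumerates m) flags (𝟙 ∘ isFlag?) rankOne (𝟙ᵇ ∘ inPerp M)
                    (cong (λ t → 𝟙 (t ≟ 0#)) ∘ trace-matMul-cong M) ⟩
      ∑[ a ∈ flags ] (𝟙 (isFlag? a) * 𝟙ᵇ (inPerp M (rankOne a))) ∎

    inKernels : Mat m → Vect m → Vect m → ℕ
    inKernels M ξ x = 𝟙 (apply ξ x ≟ 0#) * 𝟙 (apply (rowMul ξ M) (vmap σ x) ≟ 0#)

    countPerpΛ≡∑inKernels : (M : Mat m) → countPerpΛ M ≡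
      ∑[ ξ ∈ V ] (𝟙ᵇ (normalisedV ξ) * ∑[ x ∈ V ] (𝟙ᵇ (normalisedV x) * inKernels M ξ x))
    countPerpΛ≡∑inKernels M = begin
      countPerpΛ M
        ≡⟨ countPerpΛ≡∑flags M ⟩
      ∑[ a ∈ flags ] (𝟙 (isFlag? a) * 𝟙ᵇ (inPerp M (rankOne a)))
        ≡⟨ ∑-cartesianProduct V V _ ⟩
      ∑[ ξ ∈ V ] ∑[ x ∈ V ] (𝟙 (isFlag? (ξ , x)) * 𝟙ᵇ (inPerp M (rankOne (ξ , x))))
        ≡⟨ ∑-cong V (λ ξ → trans (∑-cong V (term ξ)) (∑-*ˡ (𝟙ᵇ (normalisedV ξ)) V _)) ⟩
      ∑[ ξ ∈ V ] (𝟙ᵇ (normalisedV ξ) * ∑[ x ∈ V ] (𝟙ᵇ (normalisedV x) * inKernels M ξ x)) ∎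
      where
      flag : ∀ ξ x → 𝟙 (isFlag? (ξ , x)) ≡ 𝟙ᵇ (normalisedV ξ) * 𝟙ᵇ (normalisedV x) * 𝟙 (apply ξ x ≟ 0#)
      flag ξ x = trans (𝟙-× (T? (normalisedV ξ) ×-dec T? (normalisedV x)) (apply ξ x ≟ 0#))
                       (cong (_* 𝟙 (apply ξ x ≟ 0#)) (𝟙ᵇ-∧ (normalisedV ξ) (normalisedV x)))
      perp : ∀ ξ x → 𝟙ᵇ (inPerp M (rankOne (ξ , x))) ≡ 𝟙 (apply (rowMul ξ M) (vmap σ x) ≟ 0#)
      perp ξ x = cong (λ t → 𝟙 (t ≟ 0#)) (trans (trace-outer M 1# (vmap σ x) ξ) (R.*-identityˡ _))
      term : ∀ ξ x → 𝟙 (isFlag? (ξ , x)) * 𝟙ᵇ (inPerp M (rankOne (ξ , x))) ≡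
                     𝟙ᵇ (normalisedV ξ) * (𝟙ᵇ (normalisedV x) * inKernels M ξ x)
      term ξ x = trans (cong₂ _*_ (flag ξ x) (perp ξ x))
                       (reassociate (𝟙ᵇ (normalisedV ξ)) (𝟙ᵇ (normalisedV x)) (𝟙 (apply ξ x ≟ 0#)) _)
        where
        reassociate : ∀ a b c d → a * b * c * d ≡ a * (b * (c * d))
        reassociate = solve-∀

    inKernels-cong : ∀ M ξ → inKernels M ξ Preserves _≈_ ⟶ _≡_
    inKernels-cong M ξ x≈y =
      cong₂ _*_ (cong (λ t → 𝟙 (t ≟ 0#)) (apply-congʳ ξ x≈y))
                (cong (λ t → 𝟙 (t ≟ 0#)) (apply-congʳ (rowMul ξ M) (cong σ ∘ x≈y)))

    inKernels-· : ∀ M ξ c x → c ≢ 0# → inKernels M ξ (c ·ᵥ x) ≡ inKernels M ξ x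
    inKernels-· M ξ c x c≢0 = cong₂ _*_
      (zero-test-· c≢0 (apply-·ʳ c ξ x))
      (zero-test-· (σ-≢0 c≢0) (trans (apply-congʳ ξM (vmap-·ᵥ c x)) (apply-·ʳ (σ c) ξM (vmap σ x))))
      where
      ξM = rowMul ξ M
      zero-test-· : ∀ {a b c} → c ≢ 0# → a ≡ c F.* b → 𝟙 (a ≟ 0#) ≡ 𝟙 (b ≟ 0#)
      zero-test-· {b = b} {c} c≢0 refl = 𝟙-⇔ (*-≡0⇔ c c≢0) ((c F.* b) ≟ 0#) (b ≟ 0#)

    inKernels-0 : ∀ M ξ → inKernels M ξ 0ᵥ ≡ 1
    inKernels-0 M ξ = cong₂ _*_
      (𝟙-yes (apply ξ 0ᵥ ≟ 0#) (apply-0ʳ ξ))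
      (𝟙-yes (apply ξM (vmap σ 0ᵥ) ≟ 0#) (trans (apply-congʳ ξM (λ _ → σ-0)) (apply-0ʳ ξM)))
      where
      ξM = rowMul ξ M

    ∑-inKernels-projective : ∀ M ξ →
      nonzeros * ∑[ x ∈ V ] (𝟙ᵇ (normalisedV x) * inKernels M ξ x) + 1 ≡ ∑ V (inKernels M ξ)
    ∑-inKernels-projective M ξ = sym (begin
      ∑ V (inKernels M ξ)
        ≡⟨ ∑-projective (inKernels M ξ) (inKernels-cong M ξ) (inKernels-· M ξ) ⟩
      G + inKernels M ξ 0ᵥ
        ≡⟨ cong (G +_) (inKernels-0 M ξ) ⟩
      G + 1 ∎)
      where
      G = nonzeros * ∑[ x ∈ V ] (𝟙ᵇ (normalisedV x) * inKernels M ξ x)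

  module _ {n : ℕ} (M : Mat (suc (suc n))) (ξ : Vect (suc (suc n))) where

    private
      V : List (Vect (suc (suc n)))
      V = allVects (suc (suc n))

    ∑-inKernels : ∀ k → ξ k ≢ 0# →
                  ∑ V (inKernels M ξ) ≡ order ^ n + 𝟙ᵇ (kerCond M ξ) * nonzeros * order ^ n
    ∑-inKernels k ξk≢0 = split (T? (kerCond M ξ))
      where
      W : Vect (suc (suc n)) → ℕ
      W x = 𝟙 (apply ξ x ≟ 0#)
      L : Vect (suc (suc n)) → Carrier
      L x = apply (rowMul ξ M) (vmap σ x)
      ker : ∑ V W ≡ order * order ^ n
      ker = count-kernel ξ k ξk≢0
      split : (K? : Dec (T (kerCond M ξ))) → ∑ V (inKernels M ξ) ≡ order ^ n + 𝟙 K? * nonzeros * order ^ n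
      split (yes K) = begin
        ∑ V (inKernels M ξ)
          ≡⟨ ∑-cong V (λ x → trans (𝟙-*-cong (apply ξ x ≟ 0#) (𝟙-yes (L x ≟ 0#) ∘ L≡0 x)) (*-identityʳ (W x))) ⟩
        ∑ V W
          ≡⟨ ker ⟩
        order * order ^ n
          ≡⟨ cong (_* order ^ n) order≡1+nonzeros ⟩
        order ^ n + nonzeros * order ^ n
          ≡⟨ cong (λ t → order ^ n + t * order ^ n) (+-identityʳ nonzeros) ⟨
        order ^ n + 1 * nonzeros * order ^ n ∎
        where
        L≡0 : ∀ x → apply ξ x ≡ 0# → L x ≡ 0#
        L≡0 x ξx≡0 = kerCond-sound M ξ K (vmap σ x) (trans (sym (σ-apply ξ x)) (trans (cong σ ξx≡0) σ-0))
      split (no ¬K) with kerCond-witness M ξ ¬K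
      ... | y , ξσy≡0 , ξMy≢0 =
        trans (sym (order-*-cancelˡ (trans (sym ker) fibres))) (sym (+-identityʳ (order ^ n)))
        where
        x₀ : Vect (suc (suc n))
        x₀ = vmap σ⁻ y
        σx₀≈y : vmap σ x₀ ≈ y
        σx₀≈y i = σ-σ⁻ (y i)
        ξx₀≡0 : apply ξ x₀ ≡ 0#
        ξx₀≡0 = σ-≡0 (trans (σ-apply ξ x₀) (trans (apply-congʳ (vmap σ ξ) σx₀≈y) ξσy≡0))
        Lx₀≢0 : L x₀ ≢ 0#
        Lx₀≢0 = ξMy≢0 ∘ trans (sym (apply-congʳ (rowMul ξ M) σx₀≈y))
        fibres : ∑ V W ≡ order * ∑ V (inKernels M ξ)
        fibres = ∑-fibre W L (cong (λ t → 𝟙 (t ≟ 0#)) ∘ apply-congʳ ξ)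
                             (λ u≈v → apply-congʳ (rowMul ξ M) (cong σ ∘ u≈v))
                             (λ c → let w , ξ-shift , L-shift = shift-along-kernel ξ (rowMul ξ M) x₀ ξx₀≡0 Lx₀≢0 c
                                    in w , cong (λ t → 𝟙 (t ≟ 0#)) ∘ ξ-shift , L-shift)

  module _ {n : ℕ} (M : Mat (suc (suc n))) where

    private
      V : List (Vect (suc (suc n)))
      V = allVects (suc (suc n))

    points : ℕ
    points = ∑[ ξ ∈ V ] 𝟙ᵇ (normalisedV ξ)

    nonzeros*points : nonzeros * points + 1 ≡ order ^ suc (suc n)
    nonzeros*points = begin
      nonzeros * points + 1
        ≡⟨ cong (λ t → nonzeros * t + 1) (∑-cong V (λ ξ → *-identityʳ _)) ⟨
      nonzeros * ∑[ ξ ∈ V ] (𝟙ᵇ (normalisedV ξ) * 1) + 1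
        ≡⟨ ∑-projective {suc (suc n)} (λ _ → 1) (λ _ → refl) (λ _ _ _ → refl) ⟨
      ∑[ ξ ∈ V ] 1
        ≡⟨ trans (∑-const V 1) (*-identityʳ (length V)) ⟩
      length V
        ≡⟨ length-allVects (suc (suc n)) ⟩
      order ^ suc (suc n) ∎

    θ≡∑ : θ M ≡ ∑[ ξ ∈ V ] (𝟙ᵇ (normalisedV ξ) * 𝟙ᵇ (kerCond M ξ))
    θ≡∑ = trans (length-filterᵇ≡∑ _ V) (∑-cong V (λ ξ → 𝟙ᵇ-∧ (normalisedV ξ) (kerCond M ξ)))

    nonzeros*countPerpΛ : nonzeros * countPerpΛ M + points ≡ points * order ^ n + θ M * nonzeros * order ^ n
    nonzeros*countPerpΛ = begin
      nonzeros * countPerpΛ M + points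
        ≡⟨ cong (λ t → nonzeros * t + points) (countPerpΛ≡∑inKernels M) ⟩
      nonzeros * ∑[ ξ ∈ V ] (N ξ * G ξ) + points
        ≡⟨ cong (_+ points) (∑-*ˡ nonzeros V _) ⟨
      ∑[ ξ ∈ V ] (nonzeros * (N ξ * G ξ)) + points
        ≡⟨ ∑-+ V _ _ ⟨
      ∑[ ξ ∈ V ] (nonzeros * (N ξ * G ξ) + N ξ)
        ≡⟨ ∑-cong V (λ ξ → factor nonzeros (N ξ) (G ξ)) ⟩
      ∑[ ξ ∈ V ] (N ξ * (nonzeros * G ξ + 1))
        ≡⟨ ∑-cong V (λ ξ → 𝟙-*-cong (T? (normalisedV ξ)) (count-fibre ξ)) ⟩
      ∑[ ξ ∈ V ] (N ξ * (r + K ξ * nonzeros * r))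
        ≡⟨ ∑-cong V (λ ξ → expand (N ξ) (K ξ) nonzeros r) ⟩
      ∑[ ξ ∈ V ] (N ξ * r + N ξ * K ξ * (nonzeros * r))
        ≡⟨ ∑-+ V _ _ ⟩
      ∑[ ξ ∈ V ] (N ξ * r) + ∑[ ξ ∈ V ] (N ξ * K ξ * (nonzeros * r))
        ≡⟨ cong₂ _+_ (∑-*ʳ r V N) (trans (∑-*ʳ (nonzeros * r) V _) (cong (_* (nonzeros * r)) (sym θ≡∑))) ⟩
      points * r + θ M * (nonzeros * r)
        ≡⟨ cong (points * r +_) (*-assoc (θ M) nonzeros r) ⟨
      points * r + θ M * nonzeros * r ∎
      where
      r = order ^ n
      N K G : Vect (suc (suc n)) → ℕ
      N ξ = 𝟙ᵇ (normalisedV ξ)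
      K ξ = 𝟙ᵇ (kerCond M ξ)
      G ξ = ∑[ x ∈ V ] (𝟙ᵇ (normalisedV x) * inKernels M ξ x)
      count-fibre : ∀ ξ → T (normalisedV ξ) → nonzeros * G ξ + 1 ≡ r + K ξ * nonzeros * r
      count-fibre ξ nξ = let k , ξk≡1 = lead-entry {v = ξ} (normalised-lead ξ nξ) in
        trans (∑-inKernels-projective M ξ) (∑-inKernels M ξ k (λ ξk≡0 → 1≢0 (trans (sym ξk≡1) ξk≡0)))
      factor : ∀ p a g → p * (a * g) + a ≡ a * (p * g + 1)
      factor = solve-∀
      expand : ∀ a k p r → a * (r + k * p * r) ≡ a * r + a * k * (p * r)
      expand = solve-∀

lemma3p2 : (F : FiniteField) (Aut : FieldAut F) (n : ℕ) → 1 ≤ n →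
    (M : LinAlg.Mat F (ℕ.suc n)) →
    let q = FiniteField.order F in
    Paper.countPerpΛ F Aut M * ((q ∸ 1) ^ 2)
      ≡ (q ^ (n + 1) ∸ 1) * (q ^ (n ∸ 1) ∸ 1)
        + Paper.θ F Aut M * q ^ (n ∸ 1) * ((q ∸ 1) ^ 2)
lemma3p2 F Aut (suc n) _ M = begin
  countPerpΛ M * (q ∸ 1) ^ 2
    ≡⟨ cong (λ q → countPerpΛ M * (q ∸ 1) ^ 2) order≡1+nonzeros ⟩
  countPerpΛ M * nonzeros ^ 2
    ≡⟨ counting-identity nonzeros (q ^ n) (countPerpΛ M) (points M) (θ M) (order^n>0 n) (nonzeros*countPerpΛ M) ⟩
  nonzeros * points M * (q ^ n ∸ 1) + θ M * q ^ n * nonzeros ^ 2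
    ≡⟨ cong₂ (λ a q′ → a * (q ^ n ∸ 1) + θ M * q ^ n * (q′ ∸ 1) ^ 2) nonzeros*points≡ (sym order≡1+nonzeros) ⟩
  (q ^ (suc n + 1) ∸ 1) * (q ^ n ∸ 1) + θ M * q ^ n * (q ∸ 1) ^ 2 ∎
  where
  open ≡-Reasoning
  open Counting F
  open Incidence F Aut
  open Paper F Aut using (countPerpΛ; θ)
  q = FiniteField.order F
  nonzeros*points≡ : nonzeros * points M ≡ q ^ (suc n + 1) ∸ 1
  nonzeros*points≡ = begin
    nonzeros * points M              ≡⟨ m+n∸n≡m (nonzeros * points M) 1 ⟨
    nonzeros * points M + 1 ∸ 1      ≡⟨ cong (_∸ 1) (nonzeros*points M) ⟩
    q ^ suc (suc n) ∸ 1              ≡⟨ cong (λ e → q ^ e ∸ 1) (+-comm 1 (suc n)) ⟩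
    q ^ (suc n + 1) ∸ 1              ∎
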